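{- Let $U$ be a partition of a subset of $S_c$ and $D$ a straightening set of $U$ such that $U$ is $D$-confluent. Then: (1) $(U,D)$-straightening any forward $U$-hit in a permutation $w\in S_n$ results in a permutation with the same number of $U$-hits that are both backward and not $(U,D)$-straightened as $w$; (2) $(U,D)$-straightening a backward, not $(U,D)$-straightened $U$-hit in a permutation $w\in S_n$ results in a permutation with one fewer $U$-hits that are both backward and not $(U,D)$-straightened than $w$.
   Context: Fix positive integers $c\le n$. $S_m$ is the set of permutations of $\{1,\dots,m\}$ written as words. A word $w_1\cdots w_c$ (distinct integer letters) forms $u\in S_c$ if there is an integer $k$ with $w_i=u_i+k$ for all $i$. A hit in a permutation $w\in S_n$ is a contiguous subword of length $c$ forming some $u\in S_c$. For a partition $P$ of a subset of $S_c$, a $P$-hit is a hit forming a permutation lying in some part of $P$; a $P$-rearrangement rearranges the letters of a $P$-hit in place so that the new subword forms a permutation in the same part of $P$. Tail size of a word $w$ of length $m$ with distinct letters: the least $k\ge1$ such that the first $k$ letters of $w$ are the $k$ smallest letters of $w$. $w$ is right leaning if its tail size is $<m$, left leaning if the reversal of $w$ has tail size $<m$, omni leaning if neither. Polarization of a hit $h$ in $w\in S_n$: if $h$ is all of $w$, $h$ is left polarized. Otherwise let $a$ be the average of the letters of $h$, let $w'$ be $w$ with $h$ replaced by the single letter $a$, and let $b$ be, among the letters adjacent to $a$ in $w'$, the one closest in value to $a$ (ties: the left one). If $a,b$ appear in increasing order in $w'$, $h$ is right polarized; if decreasing, left polarized. A hit is backward if it is right polarized and left leaning, or left polarized and right leaning,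 or omni leaning; otherwise forward. A straightening set $C$ of $P$ is a set of permutations from the parts of $P$ containing exactly: one left leaning permutation from each part containing a left leaning permutation, one right leaning permutation from each part containing a right leaning permutation, and one permutation from each part containing only omni leaning permutations. A $P$-hit $h$ is $(P,C)$-straightened if it forms a permutation in $C$ and either it is forward, or it is backward and no $P$-rearrangement of $h$ makes it forward. $(P,C)$-straightening a $P$-hit means applying a $P$-rearrangement so that it becomes $(P,C)$-straightened. The $(P,C)$-straightening operator $\to$ on $S_n$: $w\to w'$ iff $w'$ is obtained from $w$ by $(P,C)$-straightening a not-yet-$(P,C)$-straightened $P$-hit of $w$. A relation $\to$ on a finite set $A$ with reflexive-transitive closure $\to'$ is confluent if there are no distinct $a,b$ with $a\to'b$ and $b\to'a$, and each connected component $K$ of $(A,\to)$ has a unique node $m$ with $x\to'm$ for all $x\in K$. $P$ is $C$-confluent if the $(P,C)$-straightening operator on $S_n$ is confluent. -}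

module Defs where

open import Data.Bool using (Bool; true; false; _∧_; _∨_; not; if_then_else_)
open import Data.Nat using (ℕ; zero; suc; _+_; _*_; _∸_; _≤_; _<ᵇ_; _≤ᵇ_; _≡ᵇ_; ∣_-_∣; _⊓_)
open import Data.Integer as ℤ using (ℤ; +_)
open import Data.List using (List; []; _∷_; length; map; take; drop; reverse; upTo; _++_; foldr)
open import Data.Bool.ListAction using (all; any)
open import Data.Nat.ListAction using (sum)
open import Data.List.Properties using (≡-dec)
open import Data.Nat.Properties using (_≟_)
open import Data.Maybe using (Maybe; just; nothing)
open import Data.Empty using (⊥)
open import Relation.Nullary using (does)
open import Relation.Binary.PropositionalEquality using (_≡_; _≢_)
open import Data.List.Relation.Binary.Permutation.Propositional using (_↭_)
open import Data.List.Relation.Unary.All using (All)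
open import Data.List.Relation.Unary.Any using (Any)
open import Data.List.Relation.Unary.AllPairs using (AllPairs)
open import Data.List.Relation.Unary.Unique.Propositional using (Unique)
open import Data.List.Relation.Binary.Disjoint.Propositional using (Disjoint)
open import Data.List.Membership.Propositional using (_∈_)
open import Data.Product using (Σ; _×_; _,_)
open import Relation.Binary.Construct.Closure.ReflexiveTransitive using (Star)
open import Relation.Binary.Construct.Closure.Symmetric using (SymClosure)

Word : Set
Word = List ℕ

IsPerm : ℕ → Word → Set
IsPerm m w = w ↭ map suc (upTo m)

eqW : Word → Word → Bool
eqW u v = does (≡-dec _≟_ u v)

memW : Word → List Word → Bool
memW u p = any (eqW u) p

countB : {A : Set} → (A → Bool) → List A → ℕ
countB f [] = 0
countB f (x ∷ xs) = if f x then suc (countB f xs) else countB f xs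

-- "h forms u": same length and ∃ k ∈ ℤ with h_j = u_j + k for all j,
-- i.e. all differences h_j - u_j (in ℤ) equal the first one.

diffsConst : Word → Word → Bool
diffsConst [] _ = true
diffsConst (_ ∷ _) [] = true
diffsConst (x ∷ h) (y ∷ u) = go h u
  where
  go : Word → Word → Bool
  go (x' ∷ h') (y' ∷ u') = does ((+ x' ℤ.- + y') ℤ.≟ (+ x ℤ.- + y)) ∧ go h' u'
  go _ _ = true

forms : Word → Word → Bool
forms h u = (length h ≡ᵇ length u) ∧ diffsConst h u

-- the first k letters of w are the k smallest letters of w
-- (for distinct letters: every one of the first k letters is smaller
-- than every letter after position k)
prefixSmallest : Word → ℕ → Bool
prefixSmallest w k = all (λ x → all (λ y → x <ᵇ y) (drop k w)) (take k w)

-- least k ∈ {start, start+1, …, start+fuel-1} with p k (start+fuel if none)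
leastFrom : (ℕ → Bool) → ℕ → ℕ → ℕ
leastFrom p k zero = k
leastFrom p k (suc f) = if p k then k else leastFrom p (suc k) f

tailSize : Word → ℕ
tailSize w = leastFrom (prefixSmallest w) 1 (length w)

rightLeaning : Word → Bool
rightLeaning w = tailSize w <ᵇ length w

leftLeaning : Word → Bool
leftLeaning w = tailSize (reverse w) <ᵇ length w

omniLeaning : Word → Bool
omniLeaning w = not (rightLeaning w) ∧ not (leftLeaning w)

IsPartitionOfSubset : ℕ → List (List Word) → Set
IsPartitionOfSubset c P =
  All (λ p → p ≢ []) P × All (All (IsPerm c)) P × AllPairs Disjoint P

IsStraighteningSet : List (List Word) → List Word → Set
IsStraighteningSet P C =
  Unique C × All (λ u → Any (u ∈_) P) C ×
  All (λ p →
      (countB (λ u → memW u p ∧ leftLeaning u) C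
         ≡ (if any leftLeaning p then 1 else 0))
    × (countB (λ u → memW u p ∧ rightLeaning u) C
         ≡ (if any rightLeaning p then 1 else 0))
    × (countB (λ u → memW u p ∧ omniLeaning u) C
         ≡ (if all omniLeaning p then 1 else 0))) P

-- Hits (positions are 0-based; the hit at position i is the subword of
-- length c starting at index i).

sub : ℕ → Word → ℕ → Word
sub c w i = take c (drop i w)

replace : ℕ → Word → ℕ → Word → Word
replace c w i h' = take i w ++ h' ++ drop (i + c) w

formsIn : Word → List Word → Bool
formsIn h p = any (forms h) p

isPHit : ℕ → List (List Word) → Word → ℕ → Bool
isPHit c P w i = (i + c ≤ᵇ length w) ∧ any (formsIn (sub c w i)) P

nth : Word → ℕ → Maybe ℕ
nth [] _ = nothing
nth (x ∷ w) zero = just x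
nth (x ∷ w) (suc k) = nth w k

leftNbr : Word → ℕ → Maybe ℕ
leftNbr w zero = nothing
leftNbr w (suc i) = nth w i

rightNbr : ℕ → Word → ℕ → Maybe ℕ
rightNbr c w i = nth w (i + c)

-- With s the sum of the letters of h, a = s/c; distances
-- to a are compared after multiplying by c: c·|x - a| = |c·x - s|.
-- b is the closest neighbour (ties: the left one); h is right polarized
-- iff a and b appear in increasing order in w'.
rightPolarized : ℕ → Word → ℕ → Bool
rightPolarized c w i =
  if c ≡ᵇ length w then false else pick (leftNbr w i) (rightNbr c w i)
  where
  s : ℕ
  s = sum (sub c w i)
  d : ℕ → ℕ
  d x = ∣ c * x - s ∣
  pick : Maybe ℕ → Maybe ℕ → Bool
  pick (just l) (just r) = if d l ≤ᵇ d r then c * l <ᵇ s else s <ᵇ c * r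
  pick (just l) nothing = c * l <ᵇ s
  pick nothing (just r) = s <ᵇ c * r
  pick nothing nothing = false

leftPolarized : ℕ → Word → ℕ → Bool
leftPolarized c w i = not (rightPolarized c w i)

backward : ℕ → Word → ℕ → Bool
backward c w i =
  (rightPolarized c w i ∧ leftLeaning (sub c w i))
  ∨ (leftPolarized c w i ∧ rightLeaning (sub c w i))
  ∨ omniLeaning (sub c w i)

forward : ℕ → Word → ℕ → Bool
forward c w i = not (backward c w i)

minW : Word → ℕ
minW [] = 0
minW (x ∷ xs) = foldr _⊓_ x xs

-- Some P-rearrangement of the hit at position i makes it forward.
-- The P-rearrangements of a hit h forming a permutation in part p are
-- exactly the words u' + (min h - 1) for u' ∈ p (u' ∈ S_c).
someRearrForward : ℕ → List (List Word) → Word → ℕ → Bool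
someRearrForward c P w i =
  any (λ p → formsIn h p ∧
        any (λ u' → forward c (replace c w i (map (λ x → x + (minW h ∸ 1)) u')) i) p) P
  where
  h : Word
  h = sub c w i

straightened : ℕ → List (List Word) → List Word → Word → ℕ → Bool
straightened c P C w i =
  isPHit c P w i ∧ formsIn (sub c w i) C ∧
  (forward c w i ∨ (backward c w i ∧ not (someRearrForward c P w i)))

badCount : ℕ → List (List Word) → List Word → Word → ℕ
badCount c P C w =
  countB (λ i → isPHit c P w i ∧ backward c w i ∧ not (straightened c P C w i))
         (upTo (length w))

PRearr : ℕ → List (List Word) → Word → ℕ → Word → Set
PRearr c P w i w' =
  Σ Word λ h' → (w' ≡ replace c w i h') × (h' ↭ sub c w i) ×
    Any (λ p → (formsIn (sub c w i) p ≡ true) × (formsIn h' p ≡ true)) P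

Straighten : ℕ → List (List Word) → List Word → Word → ℕ → Word → Set
Straighten c P C w i w' = PRearr c P w i w' × (straightened c P C w' i ≡ true)

Step : ℕ → ℕ → List (List Word) → List Word → Word → Word → Set
Step c n P C w w' =
  IsPerm n w × IsPerm n w' ×
  Σ ℕ λ i → (isPHit c P w i ≡ true) × (straightened c P C w i ≡ false) ×
            Straighten c P C w i w'

Confluent : (Word → Set) → (Word → Word → Set) → Set
Confluent A R =
  (∀ a b → A a → A b → a ≢ b → Star R a b → Star R b a → ⊥) ×
  (∀ a → A a → Σ Word λ m → A m × Conn a m ×
      (∀ x → A x → Conn a x → Star R x m) ×
      (∀ m' → A m' → Conn a m' → (∀ x → A x → Conn a x → Star R x m') → m' ≡ m))
  where
  Conn : Word → Word → Set
  Conn = Star (SymClosure R)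

IsConfluentFor : ℕ → ℕ → List (List Word) → List Word → Set
IsConfluentFor c n P C = Confluent (IsPerm n) (Step c n P C)

-- Straightening the hit at position i permutes its letters, which form an interval [a, a+c) of
-- values.  A U-hit at a window j that does not overlap window i keeps its letters, which form an
-- interval disjoint from [a, a+c); at most one of its neighbours changes, and it is replaced by
-- another letter of [a, a+c), hence stays on the same side of the average of every rearrangement
-- of that hit, so whether the hit is backward and straightened does not change.  A U-hit
-- overlapping window i is forward, before and after straightening: across two overlapping hits the
-- letters rise (or fall) from the part of the first hit, through the shared part, to the part of
-- the second, which makes both hits right leaning and right polarized (or left leaning and left
-- polarized).  So only the status of position i itself can change, and a forward or straightened
-- hit is never counted.

module Submission where

open import Defs
open import Data.Bool using (Bool; true; false; T; _∧_; _∨_; not; if_then_else_)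
open import Data.Bool.ListAction using (all; any)
open import Data.Bool.Properties using (∧-zeroʳ; not-injective)
open import Data.Nat
  using (ℕ; zero; suc; _+_; _*_; _∸_; _⊓_; _≤_; _<_; _<ᵇ_; _≤ᵇ_; _≡ᵇ_; ∣_-_∣; z≤n; s≤s; >-nonZero)
open import Data.Nat.ListAction using (sum)
open import Data.Nat.Properties
open import Data.Integer as ℤ using ()
import Data.Integer.Properties as ℤ
open import Data.Integer.Tactic.RingSolver using (solve)
open import Data.List using (List; []; _∷_; length; map; take; drop; reverse; upTo; _++_; foldr)
open import Data.List.Properties
  using (length-++; length-drop; length-take; length-reverse; length-map; length-upTo; unfold-reverse;
         take++drop≡id; drop-drop; ∷-injectiveʳ)
open import Data.List.Membership.Propositional using (_∈_)
open import Data.List.Membership.Propositional.Properties using (∈-map⁺; ∈-map⁻; ∈-upTo⁺; ∈-upTo⁻)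
open import Data.List.Relation.Unary.Any using (here; there)
open import Data.List.Relation.Unary.All using (All)
import Data.List.Relation.Unary.All as All
open import Data.List.Relation.Unary.AllPairs using (_∷_)
open import Data.List.Relation.Unary.Unique.Propositional using (Unique)
import Data.List.Relation.Unary.Unique.Propositional.Properties as Unique
open import Data.List.Relation.Binary.Permutation.Propositional using (_↭_; ↭-sym; ↭⇒↭ₛ)
open import Data.List.Relation.Binary.Permutation.Propositional.Properties using (∈-resp-↭; ↭-length; ++⁺ˡ; ++⁺ʳ)
import Data.List.Relation.Binary.Permutation.Setoid.Properties as PermutationSetoid
open import Data.Maybe using (Maybe; just; nothing)
open import Data.Product using (∃-syntax; _×_; _,_; proj₁; proj₂)
open import Data.Sum using (_⊎_; inj₁; inj₂; map₁; map₂)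
open import Data.Empty using (⊥-elim)
open import Function using (_∘_)
open import Relation.Nullary using (¬_; Dec; yes; no; does)
open import Relation.Nullary.Decidable using (dec-true; dec-false)
open import Relation.Binary using (tri<; tri≈; tri>)
open import Relation.Binary.PropositionalEquality

nth-take : ∀ d (xs : Word) {k} → k < d → nth (take d xs) k ≡ nth xs k
nth-take (suc d) []       _                = refl
nth-take (suc d) (x ∷ xs) {zero}  _        = refl
nth-take (suc d) (x ∷ xs) {suc k} (s≤s k<d) = nth-take d xs k<d

nth-take-≥ : ∀ d (xs : Word) {k} → d ≤ k → nth (take d xs) k ≡ nothing
nth-take-≥ zero    xs       _         = refl
nth-take-≥ (suc d) []       _         = refl
nth-take-≥ (suc d) (x ∷ xs) (s≤s d≤k) = nth-take-≥ d xs d≤k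

nth-drop : ∀ d (xs : Word) k → nth (drop d xs) k ≡ nth xs (d + k)
nth-drop zero    xs       k = refl
nth-drop (suc d) []       k = refl
nth-drop (suc d) (x ∷ xs) k = nth-drop d xs k

nth-++ˡ : ∀ (xs ys : Word) {k} → k < length xs → nth (xs ++ ys) k ≡ nth xs k
nth-++ˡ (x ∷ xs) ys {zero}  _         = refl
nth-++ˡ (x ∷ xs) ys {suc k} (s≤s k<n) = nth-++ˡ xs ys k<n

nth-++ʳ : ∀ (xs ys : Word) k → nth (xs ++ ys) (length xs + k) ≡ nth ys k
nth-++ʳ []       ys k = refl
nth-++ʳ (x ∷ xs) ys k = nth-++ʳ xs ys k

nth-ext : ∀ (xs ys : Word) → (∀ k → nth xs k ≡ nth ys k) → xs ≡ ys
nth-ext []       []       _ = refl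
nth-ext []       (y ∷ ys) e with () ← e 0
nth-ext (x ∷ xs) []       e with () ← e 0
nth-ext (x ∷ xs) (y ∷ ys) e with refl ← e 0 = cong (x ∷_) (nth-ext xs ys (λ k → e (suc k)))

nth-just⇒< : ∀ (xs : Word) k {x} → nth xs k ≡ just x → k < length xs
nth-just⇒< (y ∷ xs) zero    _ = s≤s z≤n
nth-just⇒< (y ∷ xs) (suc k) e = s≤s (nth-just⇒< xs k e)

<⇒nth-just : ∀ (xs : Word) k → k < length xs → ∃[ x ] nth xs k ≡ just x
<⇒nth-just (y ∷ xs) zero    _         = y , refl
<⇒nth-just (y ∷ xs) (suc k) (s≤s k<n) = <⇒nth-just xs k k<n

∈⇒nth : ∀ (xs : Word) {x} → x ∈ xs → ∃[ k ] nth xs k ≡ just x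
∈⇒nth (y ∷ xs) (here refl) = 0 , refl
∈⇒nth (y ∷ xs) (there x∈) with k , e ← ∈⇒nth xs x∈ = suc k , e

nth⇒∈ : ∀ (xs : Word) k {x} → nth xs k ≡ just x → x ∈ xs
nth⇒∈ (y ∷ xs) zero    refl = here refl
nth⇒∈ (y ∷ xs) (suc k) e    = there (nth⇒∈ xs k e)

nth-injective : ∀ (w : Word) → Unique w → ∀ p q {x} → nth w p ≡ just x → nth w q ≡ just x → p ≡ q
nth-injective (y ∷ w) _          zero    zero    _    _  = refl
nth-injective (y ∷ w) (y∉ ∷ _)   zero    (suc q) refl e  = ⊥-elim (All.lookup y∉ (nth⇒∈ w q e) refl)
nth-injective (y ∷ w) (y∉ ∷ _)   (suc p) zero    e    refl = ⊥-elim (All.lookup y∉ (nth⇒∈ w p e) refl)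
nth-injective (y ∷ w) (_ ∷ uniq) (suc p) (suc q) e    e′ = cong suc (nth-injective w uniq p q e e′)

nth-reverse : ∀ (h : Word) t → t < length h → nth (reverse h) t ≡ nth h (length h ∸ suc t)
nth-reverse (x ∷ h) t t<n rewrite unfold-reverse x h with t <? length h
... | yes t<h = begin
  nth (reverse h ++ x ∷ []) t          ≡⟨ nth-++ˡ (reverse h) _ (subst (t <_) (sym (length-reverse h)) t<h) ⟩
  nth (reverse h) t                    ≡⟨ nth-reverse h t t<h ⟩
  nth h (length h ∸ suc t)             ≡⟨ cong (nth (x ∷ h)) (sym (+-∸-assoc 1 t<h)) ⟩
  nth (x ∷ h) (suc (length h) ∸ suc t) ∎
  where open ≡-Reasoning
... | no t≮h with refl ← ≤-antisym (≮⇒≥ t≮h) (≤-pred t<n) = begin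
  nth (reverse h ++ x ∷ []) (length h)
    ≡⟨ cong (nth (reverse h ++ x ∷ [])) (sym (trans (+-identityʳ _) (length-reverse h))) ⟩
  nth (reverse h ++ x ∷ []) (length (reverse h) + 0)
    ≡⟨ nth-++ʳ (reverse h) _ 0 ⟩
  just x
    ≡⟨ cong (nth (x ∷ h)) (sym (n∸n≡0 (length h))) ⟩
  nth (x ∷ h) (length h ∸ length h) ∎
  where open ≡-Reasoning

length-sub : ∀ c (w : Word) j → j + c ≤ length w → length (sub c w j) ≡ c
length-sub c w j j+c≤n = begin
  length (take c (drop j w)) ≡⟨ length-take c (drop j w) ⟩
  c ⊓ length (drop j w)      ≡⟨ m≤n⇒m⊓n≡m (subst (c ≤_) (sym (length-drop j w)) c≤n∸j) ⟩
  c                          ∎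
  where
  open ≡-Reasoning
  c≤n∸j : c ≤ length w ∸ j
  c≤n∸j = subst (_≤ length w ∸ j) (m+n∸m≡n j c) (∸-monoˡ-≤ j j+c≤n)

nth-sub : ∀ c (w : Word) j {t} → t < c → nth (sub c w j) t ≡ nth w (j + t)
nth-sub c w j {t} t<c = trans (nth-take c (drop j w) t<c) (nth-drop j w t)

nth-sub-≥ : ∀ c (w : Word) j {t} → c ≤ t → nth (sub c w j) t ≡ nothing
nth-sub-≥ c w j = nth-take-≥ c (drop j w)

sub-cong : ∀ c (v v′ : Word) j → (∀ t → t < c → nth v (j + t) ≡ nth v′ (j + t)) → sub c v j ≡ sub c v′ j
sub-cong c v v′ j e = nth-ext _ _ pointwise
  where
  pointwise : ∀ t → nth (sub c v j) t ≡ nth (sub c v′ j) t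
  pointwise t with t <? c
  ... | yes t<c = trans (nth-sub c v j t<c) (trans (e t t<c) (sym (nth-sub c v′ j t<c)))
  ... | no t≮c  = trans (nth-sub-≥ c v j (≮⇒≥ t≮c)) (sym (nth-sub-≥ c v′ j (≮⇒≥ t≮c)))

∈sub⇒nth : ∀ c (w : Word) j {x} → x ∈ sub c w j → ∃[ t ] t < c × nth w (j + t) ≡ just x
∈sub⇒nth c w j x∈ with t , e ← ∈⇒nth _ x∈ | t <? c
... | yes t<c = t , t<c , trans (sym (nth-sub c w j t<c)) e
... | no t≮c with () ← trans (sym (nth-sub-≥ c w j (≮⇒≥ t≮c))) e

nth⇒∈sub : ∀ c (w : Word) j {t x} → t < c → nth w (j + t) ≡ just x → x ∈ sub c w j
nth⇒∈sub c w j {t} t<c e = nth⇒∈ _ t (trans (nth-sub c w j t<c) e)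

take-sub-drop : ∀ c (w : Word) i → take i w ++ sub c w i ++ drop (i + c) w ≡ w
take-sub-drop c w i = begin
  take i w ++ take c (drop i w) ++ drop (i + c) w    ≡⟨ cong (take i w ++_) (cong (take c (drop i w) ++_) (drop-drop i c w)) ⟨
  take i w ++ take c (drop i w) ++ drop c (drop i w) ≡⟨ cong (take i w ++_) (take++drop≡id c (drop i w)) ⟩
  take i w ++ drop i w                               ≡⟨ take++drop≡id i w ⟩
  w                                                  ∎
  where open ≡-Reasoning

replace-↭ : ∀ c (w h′ : Word) i → h′ ↭ sub c w i → replace c w i h′ ↭ w
replace-↭ c w h′ i h′↭h = subst (replace c w i h′ ↭_) (take-sub-drop c w i)
  (++⁺ˡ (take i w) (++⁺ʳ (drop (i + c) w) h′↭h))

leftNbr-cong : ∀ (v v′ : Word) j → (∀ {k} → suc k ≡ j → nth v k ≡ nth v′ k) → leftNbr v j ≡ leftNbr v′ j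
leftNbr-cong v v′ zero    _     = refl
leftNbr-cong v v′ (suc k) agree = agree refl

module _ (c : ℕ) (w h′ : Word) (i : ℕ) (i+c≤n : i + c ≤ length w) (|h′|≡c : length h′ ≡ c) where

  private
    |take|≡i : length (take i w) ≡ i
    |take|≡i = trans (length-take i w) (m≤n⇒m⊓n≡m (≤-trans (m≤m+n i c) i+c≤n))

  length-replace : length (replace c w i h′) ≡ length w
  length-replace = begin
    length (take i w ++ h′ ++ drop (i + c) w)         ≡⟨ length-++ (take i w) ⟩
    length (take i w) + length (h′ ++ drop (i + c) w) ≡⟨ cong₂ _+_ |take|≡i (length-++ h′) ⟩
    i + (length h′ + length (drop (i + c) w))         ≡⟨ cong₂ (λ m n → i + (m + n)) |h′|≡c (length-drop (i + c) w) ⟩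
    i + (c + (length w ∸ (i + c)))                    ≡⟨ +-assoc i c _ ⟨
    i + c + (length w ∸ (i + c))                      ≡⟨ m+[n∸m]≡n i+c≤n ⟩
    length w                                          ∎
    where open ≡-Reasoning

  nth-replace-< : ∀ {k} → k < i → nth (replace c w i h′) k ≡ nth w k
  nth-replace-< k<i = trans (nth-++ˡ (take i w) _ (subst (_ <_) (sym |take|≡i) k<i)) (nth-take i w k<i)

  nth-replace-inside : ∀ t → nth (replace c w i h′) (i + t) ≡ nth (h′ ++ drop (i + c) w) t
  nth-replace-inside t =
    subst (λ z → nth (replace c w i h′) (z + t) ≡ nth (h′ ++ drop (i + c) w) t) |take|≡i (nth-++ʳ (take i w) _ t)

  nth-replace-≥ : ∀ {k} → i + c ≤ k → nth (replace c w i h′) k ≡ nth w k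
  nth-replace-≥ {k} i+c≤k with t , refl ← m≤n⇒∃[o]m+o≡n i+c≤k = begin
    nth (replace c w i h′) (i + c + t)       ≡⟨ cong (nth (replace c w i h′)) (+-assoc i c t) ⟩
    nth (replace c w i h′) (i + (c + t))     ≡⟨ nth-replace-inside (c + t) ⟩
    nth (h′ ++ drop (i + c) w) (c + t)       ≡⟨ subst (λ z → nth (h′ ++ drop (i + c) w) (z + t) ≡ nth (drop (i + c) w) t)
                                                      |h′|≡c (nth-++ʳ h′ _ t) ⟩
    nth (drop (i + c) w) t                   ≡⟨ nth-drop (i + c) w t ⟩
    nth w (i + c + t)                        ∎
    where open ≡-Reasoning

  nth-replace-outside : ∀ {k} → k < i ⊎ i + c ≤ k → nth (replace c w i h′) k ≡ nth w k
  nth-replace-outside (inj₁ k<i)   = nth-replace-< k<i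
  nth-replace-outside (inj₂ i+c≤k) = nth-replace-≥ i+c≤k

  sub-replace : sub c (replace c w i h′) i ≡ h′
  sub-replace = nth-ext _ _ pointwise
    where
    pointwise : ∀ t → nth (sub c (replace c w i h′) i) t ≡ nth h′ t
    pointwise t with t <? c
    ... | yes t<c = begin
      nth (sub c (replace c w i h′) i) t   ≡⟨ nth-sub c _ i t<c ⟩
      nth (replace c w i h′) (i + t)       ≡⟨ nth-replace-inside t ⟩
      nth (h′ ++ drop (i + c) w) t         ≡⟨ nth-++ˡ h′ _ (subst (t <_) (sym |h′|≡c) t<c) ⟩
      nth h′ t                             ∎
      where open ≡-Reasoning
    ... | no t≮c with nth h′ t in e
    ...   | nothing = nth-sub-≥ c _ i (≮⇒≥ t≮c)
    ...   | just _  = ⊥-elim (t≮c (subst (t <_) |h′|≡c (nth-just⇒< h′ t e)))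

  leftNbr-replace : leftNbr (replace c w i h′) i ≡ leftNbr w i
  leftNbr-replace = leftNbr-cong _ _ i λ { refl → nth-replace-< ≤-refl }

  rightNbr-replace : rightNbr c (replace c w i h′) i ≡ rightNbr c w i
  rightNbr-replace = nth-replace-≥ ≤-refl

-- The letters of a hit form an interval

∧-true⁻ : ∀ {a b} → a ∧ b ≡ true → a ≡ true × b ≡ true
∧-true⁻ {true} {true} _ = refl , refl

does-true⁻ : ∀ {A : Set} (a? : Dec A) → does a? ≡ true → A
does-true⁻ (yes a) _ = a

any-true⁻ : ∀ {A : Set} (f : A → Bool) (xs : List A) → any f xs ≡ true → ∃[ x ] x ∈ xs × f x ≡ true
any-true⁻ f (x ∷ xs) e with f x in fx
... | true  = x , here refl , fx
... | false with y , y∈ , fy ← any-true⁻ f xs e = y , there y∈ , fy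

length-perm : ∀ {c} {u : Word} → IsPerm c u → length u ≡ c
length-perm {c} u↭ = trans (↭-length u↭) (trans (length-map suc (upTo c)) (length-upTo c))

∈-perm⁻ : ∀ {c} {u : Word} {t} → IsPerm c u → t ∈ u → ∃[ k ] k < c × t ≡ suc k
∈-perm⁻ u↭ t∈ with k , k∈ , refl ← ∈-map⁻ suc (∈-resp-↭ u↭ t∈) = k , ∈-upTo⁻ k∈ , refl

∈-perm⁺ : ∀ {c} {u : Word} {k} → IsPerm c u → k < c → suc k ∈ u
∈-perm⁺ u↭ k<c = ∈-resp-↭ (↭-sym u↭) (∈-map⁺ suc (∈-upTo⁺ k<c))

ℤ-diff-eq⇒sum-eq : ∀ a b c d → a ℤ.- b ≡ c ℤ.- d → a ℤ.+ d ≡ b ℤ.+ c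
ℤ-diff-eq⇒sum-eq a b c d e = begin
  a ℤ.+ d                   ≡⟨ solve (a ∷ b ∷ d ∷ []) ⟩
  (a ℤ.- b) ℤ.+ (b ℤ.+ d)   ≡⟨ cong (ℤ._+ (b ℤ.+ d)) e ⟩
  (c ℤ.- d) ℤ.+ (b ℤ.+ d)   ≡⟨ solve (b ∷ c ∷ d ∷ []) ⟩
  b ℤ.+ c                   ∎
  where open ≡-Reasoning

diff-eq⇒sum-eq : ∀ v t x y → ℤ.+ v ℤ.- ℤ.+ t ≡ ℤ.+ x ℤ.- ℤ.+ y → v + y ≡ t + x
diff-eq⇒sum-eq v t x y e = ℤ.+-injective (begin
  ℤ.+ (v + y)       ≡⟨ ℤ.pos-+ v y ⟩
  ℤ.+ v ℤ.+ ℤ.+ y   ≡⟨ ℤ-diff-eq⇒sum-eq (ℤ.+ v) (ℤ.+ t) (ℤ.+ x) (ℤ.+ y) e ⟩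
  ℤ.+ t ℤ.+ ℤ.+ x   ≡⟨ ℤ.pos-+ t x ⟨
  ℤ.+ (t + x)       ∎)
  where open ≡-Reasoning

-- `diffsConst (x ∷ v ∷ h) (y ∷ t ∷ u)` unfolds to a test on v, t followed by `diffsConst (x ∷ h) (y ∷ u)`.
diffsConst⇒shift : ∀ x y (h u : Word) → length h ≡ length u → diffsConst (x ∷ h) (y ∷ u) ≡ true →
                   map (_+ y) (x ∷ h) ≡ map (_+ x) (y ∷ u)
diffsConst⇒shift x y []       []       _   _ = cong (_∷ []) (+-comm x y)
diffsConst⇒shift x y (v ∷ h) (t ∷ u) |h|≡ e
  with same , rest ← ∧-true⁻ {does ((ℤ.+ v ℤ.- ℤ.+ t) ℤ.≟ (ℤ.+ x ℤ.- ℤ.+ y))} e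
  with eq ← diffsConst⇒shift x y h u (suc-injective |h|≡) rest =
  cong₂ _∷_ (+-comm x y)
    (cong₂ _∷_ (diff-eq⇒sum-eq v t x y (does-true⁻ ((ℤ.+ v ℤ.- ℤ.+ t) ℤ.≟ (ℤ.+ x ℤ.- ℤ.+ y)) same)) (∷-injectiveʳ eq))

record LetterRange (b c : ℕ) (h : Word) : Set where
  field
    bounded  : ∀ {v} → v ∈ h → b ≤ v × v < b + c
    complete : ∀ {v} → b ≤ v → v < b + c → v ∈ h

private
  offset-cancel : ∀ v y k x b → v + y ≡ suc k + x → b + y ≡ suc x → v ≡ k + b
  offset-cancel v y k x b e e₁ = +-cancelʳ-≡ y v (k + b) (begin
    v + y        ≡⟨ e ⟩
    suc k + x    ≡⟨ +-suc k x ⟨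
    k + suc x    ≡⟨ cong (λ z → k + z) e₁ ⟨
    k + (b + y)  ≡⟨ +-assoc k b y ⟨
    k + b + y    ∎)
    where open ≡-Reasoning

forms⇒LetterRange : ∀ {c} {h u : Word} → 1 ≤ c → IsPerm c u → forms h u ≡ true →
                    (∀ {v} → v ∈ h → 1 ≤ v) → ∃[ b ] 1 ≤ b × LetterRange b c h
forms⇒LetterRange {h = []}     {[]}     c≥1 u↭ e positive with () ← ∈-perm⁺ u↭ c≥1
forms⇒LetterRange {h = []}     {_ ∷ _}  c≥1 u↭ ()
forms⇒LetterRange {h = _ ∷ _}  {[]}     c≥1 u↭ ()
forms⇒LetterRange {c} {x ∷ h′} {y ∷ u′} c≥1 u↭ e positive =
  b , positive b∈h , record { bounded = bounded ; complete = complete }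
  where
  shift : map (_+ y) (x ∷ h′) ≡ map (_+ x) (y ∷ u′)
  shift with |h|≡|u| , consistent ← ∧-true⁻ e =
    diffsConst⇒shift x y h′ u′ (≡ᵇ⇒≡ _ _ (subst T (sym |h|≡|u|) _)) consistent

  partner : ∀ {v} → v ∈ x ∷ h′ → ∃[ t ] t ∈ y ∷ u′ × v + y ≡ t + x
  partner {v} v∈ with t , t∈ , eq ← ∈-map⁻ (_+ x) (subst (v + y ∈_) shift (∈-map⁺ (_+ y) v∈)) = t , t∈ , eq

  partner⁻ : ∀ {t} → t ∈ y ∷ u′ → ∃[ v ] v ∈ x ∷ h′ × v + y ≡ t + x
  partner⁻ {t} t∈ with v , v∈ , eq ← ∈-map⁻ (_+ y) (subst (t + x ∈_) (sym shift) (∈-map⁺ (_+ x) t∈)) = v , v∈ , sym eq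

  b : ℕ
  b = proj₁ (partner⁻ (∈-perm⁺ u↭ c≥1))
  b∈h : b ∈ x ∷ h′
  b∈h = proj₁ (proj₂ (partner⁻ (∈-perm⁺ u↭ c≥1)))
  b+y≡1+x : b + y ≡ suc x
  b+y≡1+x = proj₂ (proj₂ (partner⁻ (∈-perm⁺ u↭ c≥1)))

  bounded : ∀ {v} → v ∈ x ∷ h′ → b ≤ v × v < b + c
  bounded {v} v∈ with t , t∈ , eq ← partner v∈ with k , k<c , refl ← ∈-perm⁻ u↭ t∈
    with refl ← offset-cancel v y k x b eq b+y≡1+x = m≤n+m b k , subst (_< b + c) (+-comm b k) (+-monoʳ-< b k<c)

  complete : ∀ {v} → b ≤ v → v < b + c → v ∈ x ∷ h′
  complete b≤v v<b+c with k , refl ← m≤n⇒∃[o]m+o≡n b≤v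
    with v , v∈ , eq ← partner⁻ (∈-perm⁺ u↭ (+-cancelˡ-< b k c v<b+c))
    with refl ← offset-cancel v y k x b eq b+y≡1+x = subst (_∈ x ∷ h′) (+-comm k b) v∈

all-true⁺ : ∀ {A : Set} (f : A → Bool) (xs : List A) → (∀ {x} → x ∈ xs → f x ≡ true) → all f xs ≡ true
all-true⁺ f []       _    = refl
all-true⁺ f (x ∷ xs) f≡true rewrite f≡true (here refl) = all-true⁺ f xs (λ x∈ → f≡true (there x∈))

all-false⁺ : ∀ {A : Set} (f : A → Bool) (xs : List A) {x} → x ∈ xs → f x ≡ false → all f xs ≡ false
all-false⁺ f (y ∷ xs) (here refl) fx rewrite fx = refl
all-false⁺ f (y ∷ xs) (there x∈) fx with f y
... | true  = all-false⁺ f xs x∈ fx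
... | false = refl

leastFrom-≤ : ∀ (p : ℕ → Bool) k f {k₀} → p k₀ ≡ true → k ≤ k₀ → k₀ < k + f → leastFrom p k f ≤ k₀
leastFrom-≤ p k zero    _   k≤k₀ k₀<k+0 = ⊥-elim (<⇒≱ k₀<k+0 (subst (_≤ _) (sym (+-identityʳ k)) k≤k₀))
leastFrom-≤ p k (suc f) {k₀} pk₀ k≤k₀ k₀<k+f with p k in pk
... | true  = k≤k₀
... | false with m≤n⇒m<n∨m≡n k≤k₀
...   | inj₁ k<k₀ = leastFrom-≤ p (suc k) f pk₀ k<k₀ (subst (k₀ <_) (+-suc k f) k₀<k+f)
...   | inj₂ refl with () ← trans (sym pk) pk₀

leastFrom-≥ : ∀ (p : ℕ → Bool) k f {K} → (∀ m → k ≤ m → m < K → p m ≡ false) → K ≤ k + f → K ≤ leastFrom p k f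
leastFrom-≥ p k zero    _     K≤k+0 = subst (_ ≤_) (+-identityʳ k) K≤k+0
leastFrom-≥ p k (suc f) {K} below K≤k+f with p k in pk
... | true with k <? K
...   | yes k<K with () ← trans (sym (below k ≤-refl k<K)) pk
...   | no  k≮K = ≮⇒≥ k≮K
leastFrom-≥ p k (suc f) {K} below K≤k+f | false =
  leastFrom-≥ p (suc k) f (λ m k<m → below m (<⇒≤ k<m)) (subst (K ≤_) (+-suc k f) K≤k+f)

∈take⇒nth : ∀ k (xs : Word) {x} → x ∈ take k xs → ∃[ t ] t < k × nth xs t ≡ just x
∈take⇒nth k xs x∈ with t , e ← ∈⇒nth _ x∈ | t <? k
... | yes t<k = t , t<k , trans (sym (nth-take k xs t<k)) e
... | no  t≮k with () ← trans (sym (nth-take-≥ k xs (≮⇒≥ t≮k))) e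

∈drop⇒nth : ∀ k (xs : Word) {x} → x ∈ drop k xs → ∃[ t ] k ≤ t × nth xs t ≡ just x
∈drop⇒nth k xs x∈ with t , e ← ∈⇒nth _ x∈ = k + t , m≤m+n k t , trans (sym (nth-drop k xs t)) e

nth⇒∈take : ∀ k (xs : Word) {t x} → t < k → nth xs t ≡ just x → x ∈ take k xs
nth⇒∈take k xs {t} t<k e = nth⇒∈ _ t (trans (nth-take k xs t<k) e)

nth⇒∈drop : ∀ k (xs : Word) {t x} → k ≤ t → nth xs t ≡ just x → x ∈ drop k xs
nth⇒∈drop k xs k≤t e with o , refl ← m≤n⇒∃[o]m+o≡n k≤t = nth⇒∈ _ o (trans (nth-drop k xs o) e)

rightLeaning-split : ∀ (h : Word) k → 1 ≤ k → k < length h →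
  (∀ {t t′ x y} → t < k → k ≤ t′ → nth h t ≡ just x → nth h t′ ≡ just y → x < y) →
  rightLeaning h ≡ true
rightLeaning-split h k 1≤k k<n smaller = dec-true (_ <? length h) (≤-<-trans tailSize≤k k<n)
  where
  prefix : prefixSmallest h k ≡ true
  prefix = all-true⁺ _ (take k h) λ x∈ → all-true⁺ _ (drop k h) λ y∈ →
    let t , t<k , ex = ∈take⇒nth k h x∈ ; t′ , k≤t′ , ey = ∈drop⇒nth k h y∈
    in dec-true (_ <? _) (smaller t<k k≤t′ ex ey)
  tailSize≤k : tailSize h ≤ k
  tailSize≤k = leastFrom-≤ (prefixSmallest h) 1 (length h) prefix 1≤k (s≤s (<⇒≤ k<n))

rightLeaning-last≤first : ∀ (h : Word) → 0 < length h →
  (∀ {x z} → nth h 0 ≡ just x → nth h (length h ∸ 1) ≡ just z → z ≤ x) → rightLeaning h ≡ false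
rightLeaning-last≤first h 0<n last≤first = dec-false (_ <? length h) (≤⇒≯ n≤tailSize)
  where
  n-1<n : length h ∸ 1 < length h
  n-1<n = ∸-monoʳ-< {o = 0} (s≤s z≤n) 0<n
  no-prefix : ∀ m → 1 ≤ m → m < length h → prefixSmallest h m ≡ false
  no-prefix m 1≤m m<n with x , first ← <⇒nth-just h 0 0<n | z , last ← <⇒nth-just h (length h ∸ 1) n-1<n =
    all-false⁺ _ (take m h) (nth⇒∈take m h 1≤m first)
      (all-false⁺ _ (drop m h) (nth⇒∈drop m h (≤-pred (subst (m <_) (sym (m+[n∸m]≡n 0<n)) m<n)) last)
        (dec-false (x <? z) (≤⇒≯ (last≤first first last))))
  n≤tailSize : length h ≤ tailSize h
  n≤tailSize = leastFrom-≥ (prefixSmallest h) 1 (length h) no-prefix (n≤1+n _)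

leftLeaning-reverse : ∀ (h : Word) → leftLeaning h ≡ rightLeaning (reverse h)
leftLeaning-reverse h = cong (tailSize (reverse h) <ᵇ_) (sym (length-reverse h))

leftLeaning-split : ∀ (h : Word) k → 1 ≤ k → k < length h →
  (∀ {t t′ x y} → k ≤ t → t′ < k → nth h t ≡ just x → nth h t′ ≡ just y → x < y) →
  leftLeaning h ≡ true
leftLeaning-split h k 1≤k k<n larger = trans (leftLeaning-reverse h)
  (rightLeaning-split (reverse h) (n ∸ k) (m<n⇒0<n∸m k<n) (subst (n ∸ k <_) (sym (length-reverse h)) n-k<n) reversed)
  where
  n = length h
  n-k<n : n ∸ k < n
  n-k<n = ∸-monoʳ-< {o = 0} 1≤k (<⇒≤ k<n)
  n-[n-k]≡k : n ∸ (n ∸ k) ≡ k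
  n-[n-k]≡k = m∸[m∸n]≡n (<⇒≤ k<n)
  position : ∀ {t x} → nth (reverse h) t ≡ just x → t < n × nth h (n ∸ suc t) ≡ just x
  position {t} e with t<n ← subst (t <_) (length-reverse h) (nth-just⇒< (reverse h) t e) =
    t<n , trans (sym (nth-reverse h t t<n)) e
  reversed : ∀ {t t′ x y} → t < n ∸ k → n ∸ k ≤ t′ →
             nth (reverse h) t ≡ just x → nth (reverse h) t′ ≡ just y → x < y
  reversed {t} {t′} t<n-k n-k≤t′ ex ey with _ , ex′ ← position ex | t′<n , ey′ ← position ey =
    larger (subst (_≤ n ∸ suc t) n-[n-k]≡k (∸-monoʳ-≤ n t<n-k))
           (subst (n ∸ suc t′ <_) n-[n-k]≡k (∸-monoʳ-< (s≤s n-k≤t′) t′<n)) ex′ ey′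

leftLeaning-first≤last : ∀ (h : Word) → 0 < length h →
  (∀ {x z} → nth h 0 ≡ just x → nth h (length h ∸ 1) ≡ just z → x ≤ z) → leftLeaning h ≡ false
leftLeaning-first≤last h 0<n first≤last = trans (leftLeaning-reverse h)
  (rightLeaning-last≤first (reverse h) (subst (0 <_) (sym (length-reverse h)) 0<n)
    λ rfirst rlast → first≤last (trans (sym reversed-last) rlast) (trans (sym reversed-first) rfirst))
  where
  n = length h
  reversed-first : nth (reverse h) 0 ≡ nth h (n ∸ 1)
  reversed-first = nth-reverse h 0 0<n
  reversed-last : nth (reverse h) (length (reverse h) ∸ 1) ≡ nth h 0
  reversed-last = begin
    nth (reverse h) (length (reverse h) ∸ 1) ≡⟨ cong (λ m → nth (reverse h) (m ∸ 1)) (length-reverse h) ⟩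
    nth (reverse h) (n ∸ 1)                  ≡⟨ nth-reverse h (n ∸ 1) (∸-monoʳ-< {o = 0} (s≤s z≤n) 0<n) ⟩
    nth h (n ∸ suc (n ∸ 1))                  ≡⟨ cong (λ m → nth h (n ∸ m)) (m+[n∸m]≡n 0<n) ⟩
    nth h (n ∸ n)                            ≡⟨ cong (nth h) (n∸n≡0 n) ⟩
    nth h 0                                  ∎
    where open ≡-Reasoning

-- The local `pick` of `rightPolarized`, for a hit with letter sum s.
nbrIncreasing : ℕ → ℕ → Maybe ℕ → Maybe ℕ → Bool
nbrIncreasing c s (just l) (just r) = if ∣ c * l - s ∣ ≤ᵇ ∣ c * r - s ∣ then c * l <ᵇ s else s <ᵇ c * r
nbrIncreasing c s (just l) nothing  = c * l <ᵇ s
nbrIncreasing c s nothing  (just r) = s <ᵇ c * r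
nbrIncreasing c s nothing  nothing  = false

rightPolarizedBy : ℕ → ℕ → ℕ → Maybe ℕ → Maybe ℕ → Bool
rightPolarizedBy c len s l r = if c ≡ᵇ len then false else nbrIncreasing c s l r

backwardBy : ℕ → ℕ → Word → Maybe ℕ → Maybe ℕ → Bool
backwardBy c len h l r =
  (rightPolarizedBy c len (sum h) l r ∧ leftLeaning h)
  ∨ (not (rightPolarizedBy c len (sum h) l r) ∧ rightLeaning h)
  ∨ omniLeaning h

rearrangement : Word → Word → Word
rearrangement h u′ = map (λ x → x + (minW h ∸ 1)) u′

rearrangesForwardBy : ℕ → List (List Word) → ℕ → Word → Maybe ℕ → Maybe ℕ → Bool
rearrangesForwardBy c P len h l r =
  any (λ p → formsIn h p ∧ any (λ u′ → not (backwardBy c len (rearrangement h u′) l r)) p) P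

straightenedBy : ℕ → List (List Word) → List Word → ℕ → Word → Maybe ℕ → Maybe ℕ → Bool
straightenedBy c P C len h l r = any (formsIn h) P ∧ formsIn h C ∧
  (not (backwardBy c len h l r) ∨ (backwardBy c len h l r ∧ not (rearrangesForwardBy c P len h l r)))

badBy : ℕ → List (List Word) → List Word → ℕ → Word → Maybe ℕ → Maybe ℕ → Bool
badBy c P C len h l r = any (formsIn h) P ∧ backwardBy c len h l r ∧ not (straightenedBy c P C len h l r)

bad : ℕ → List (List Word) → List Word → Word → ℕ → Bool
bad c P C w i = isPHit c P w i ∧ backward c w i ∧ not (straightened c P C w i)

rightPolarized-local : ∀ c w i →
  rightPolarized c w i ≡ rightPolarizedBy c (length w) (sum (sub c w i)) (leftNbr w i) (rightNbr c w i)
rightPolarized-local c w i with leftNbr w i | rightNbr c w i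
... | just l  | just r  = refl
... | just l  | nothing = refl
... | nothing | just r  = refl
... | nothing | nothing = refl

backward-local : ∀ c w i →
  backward c w i ≡ backwardBy c (length w) (sub c w i) (leftNbr w i) (rightNbr c w i)
backward-local c w i rewrite rightPolarized-local c w i = refl

any-cong : ∀ {A : Set} {f g : A → Bool} (xs : List A) → (∀ {x} → x ∈ xs → f x ≡ g x) → any f xs ≡ any g xs
any-cong []       _     = refl
any-cong (x ∷ xs) f≡g = cong₂ _∨_ (f≡g (here refl)) (any-cong xs (λ x∈ → f≡g (there x∈)))

isPHit-local : ∀ c P w i → i + c ≤ length w → isPHit c P w i ≡ any (formsIn (sub c w i)) P
isPHit-local c P w i i+c≤n rewrite dec-true (i + c ≤? length w) i+c≤n = refl

module _ (c : ℕ) (P : List (List Word)) (parts : All (All (IsPerm c)) P) where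

  rearrangesForward-local : ∀ w i → i + c ≤ length w →
    someRearrForward c P w i ≡ rearrangesForwardBy c P (length w) (sub c w i) (leftNbr w i) (rightNbr c w i)
  rearrangesForward-local w i i+c≤n = any-cong P λ {p} p∈ → cong (formsIn (sub c w i) p ∧_) (any-cong p λ u′∈ →
    cong not (rearranged-local (length-perm (All.lookup (All.lookup parts p∈) u′∈))))
    where
    rearranged-local : ∀ {u′} → length u′ ≡ c →
      backward c (replace c w i (rearrangement (sub c w i) u′)) i
        ≡ backwardBy c (length w) (rearrangement (sub c w i) u′) (leftNbr w i) (rightNbr c w i)
    rearranged-local {u′} |u′|≡c = begin
      backward c w′ i
        ≡⟨ backward-local c w′ i ⟩
      backwardBy c (length w′) (sub c w′ i) (leftNbr w′ i) (rightNbr c w′ i)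
        ≡⟨ cong₂ (λ n h → backwardBy c n h (leftNbr w′ i) (rightNbr c w′ i)) (length-replace c w X i i+c≤n |X|≡c)
                                                                           (sub-replace c w X i i+c≤n |X|≡c) ⟩
      backwardBy c (length w) X (leftNbr w′ i) (rightNbr c w′ i)
        ≡⟨ cong₂ (backwardBy c (length w) X) (leftNbr-replace c w X i i+c≤n |X|≡c) (rightNbr-replace c w X i i+c≤n |X|≡c) ⟩
      backwardBy c (length w) X (leftNbr w i) (rightNbr c w i) ∎
      where
      open ≡-Reasoning
      X = rearrangement (sub c w i) u′
      w′ = replace c w i X
      |X|≡c : length X ≡ c
      |X|≡c = trans (length-map _ u′) |u′|≡c

  bad-local : ∀ C w i → i + c ≤ length w →
    bad c P C w i ≡ badBy c P C (length w) (sub c w i) (leftNbr w i) (rightNbr c w i)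
  bad-local C w i i+c≤n
    rewrite isPHit-local c P w i i+c≤n | backward-local c w i | rearrangesForward-local w i i+c≤n = refl

-- Moving a neighbour without crossing the average

private
  dist-below : ∀ {x s} → x ≤ s → ∣ x - s ∣ ≡ s ∸ x
  dist-below {x} {s} x≤s = trans (∣-∣-comm x s) (m≤n⇒∣n-m∣≡n∸m x≤s)

  dist-above : ∀ {x s} → s ≤ x → ∣ x - s ∣ ≡ x ∸ s
  dist-above = m≤n⇒∣n-m∣≡n∸m

  closer-below : ∀ {x y s} → y < x → x ≤ s → ∣ x - s ∣ < ∣ y - s ∣
  closer-below y<x x≤s rewrite dist-below x≤s | dist-below (≤-trans (<⇒≤ y<x) x≤s) = ∸-monoʳ-< y<x x≤s

  closer-above : ∀ {x y s} → s ≤ x → x < y → ∣ x - s ∣ < ∣ y - s ∣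
  closer-above s≤x x<y rewrite dist-above s≤x | dist-above (≤-trans s≤x (<⇒≤ x<y)) = ∸-monoˡ-< x<y s≤x

  scale-< : ∀ c {x y} → 1 ≤ c → x < y → c * x < c * y
  scale-< c c≥1 = *-monoʳ-< c {{>-nonZero c≥1}}

  <ᵇ-true : ∀ {m n} → m < n → (m <ᵇ n) ≡ true
  <ᵇ-true {m} {n} = dec-true (m <? n)

  <ᵇ-false : ∀ {m n} → n ≤ m → (m <ᵇ n) ≡ false
  <ᵇ-false {m} {n} n≤m = dec-false (m <? n) (≤⇒≯ n≤m)

  left-closer : ∀ c s l r → ∣ c * l - s ∣ < ∣ c * r - s ∣ → nbrIncreasing c s (just l) (just r) ≡ (c * l <ᵇ s)
  left-closer c s l r closer rewrite dec-true (∣ c * l - s ∣ ≤? ∣ c * r - s ∣) (<⇒≤ closer) = refl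

  right-closer : ∀ c s l r → ∣ c * r - s ∣ < ∣ c * l - s ∣ → nbrIncreasing c s (just l) (just r) ≡ (s <ᵇ c * r)
  right-closer c s l r closer rewrite dec-false (∣ c * l - s ∣ ≤? ∣ c * r - s ∣) (<⇒≱ closer) = refl

  same-value : ∀ {x y v : Bool} → x ≡ v → y ≡ v → x ≡ y
  same-value x≡v y≡v = trans x≡v (sym y≡v)

  both-agree : ∀ c s l r v → (c * l <ᵇ s) ≡ v → (s <ᵇ c * r) ≡ v → nbrIncreasing c s (just l) (just r) ≡ v
  both-agree c s l r v left right with ∣ c * l - s ∣ ≤ᵇ ∣ c * r - s ∣
  ... | true  = left
  ... | false = right

nbrIncreasing-left-invariant : ∀ c s l l′ r → 1 ≤ c →
  (c * l < s × c * l′ < s) ⊎ (s < c * l × s < c * l′) →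
  (∀ r₀ → r ≡ just r₀ → (r₀ < l × r₀ < l′) ⊎ (l < r₀ × l′ < r₀)) →
  nbrIncreasing c s (just l) r ≡ nbrIncreasing c s (just l′) r
nbrIncreasing-left-invariant c s l l′ nothing c≥1 (inj₁ (p , p′)) _ = same-value (<ᵇ-true p) (<ᵇ-true p′)
nbrIncreasing-left-invariant c s l l′ nothing c≥1 (inj₂ (p , p′)) _ = same-value (<ᵇ-false (<⇒≤ p)) (<ᵇ-false (<⇒≤ p′))
nbrIncreasing-left-invariant c s l l′ (just r) c≥1 (inj₁ (p , p′)) order with s <? c * r | order r refl
... | yes q | _ = same-value (both-agree c s l r true (<ᵇ-true p) (<ᵇ-true q))
                             (both-agree c s l′ r true (<ᵇ-true p′) (<ᵇ-true q))
... | no q | inj₁ (o , o′) =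
  same-value (trans (left-closer c s l r (closer-below (scale-< c c≥1 o) (<⇒≤ p))) (<ᵇ-true p))
             (trans (left-closer c s l′ r (closer-below (scale-< c c≥1 o′) (<⇒≤ p′))) (<ᵇ-true p′))
... | no q | inj₂ (o , o′) =
  same-value (right-closer c s l r (closer-below (scale-< c c≥1 o) (≮⇒≥ q)))
             (right-closer c s l′ r (closer-below (scale-< c c≥1 o′) (≮⇒≥ q)))
nbrIncreasing-left-invariant c s l l′ (just r) c≥1 (inj₂ (p , p′)) order with c * r <? s | order r refl
... | yes q | _ = same-value (both-agree c s l r false (<ᵇ-false (<⇒≤ p)) (<ᵇ-false (<⇒≤ q)))
                             (both-agree c s l′ r false (<ᵇ-false (<⇒≤ p′)) (<ᵇ-false (<⇒≤ q)))
... | no q | inj₂ (o , o′) =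
  same-value (trans (left-closer c s l r (closer-above (<⇒≤ p) (scale-< c c≥1 o))) (<ᵇ-false (<⇒≤ p)))
             (trans (left-closer c s l′ r (closer-above (<⇒≤ p′) (scale-< c c≥1 o′))) (<ᵇ-false (<⇒≤ p′)))
... | no q | inj₁ (o , o′) =
  same-value (right-closer c s l r (closer-above (≮⇒≥ q) (scale-< c c≥1 o)))
             (right-closer c s l′ r (closer-above (≮⇒≥ q) (scale-< c c≥1 o′)))

nbrIncreasing-right-invariant : ∀ c s l r r′ → 1 ≤ c →
  (c * r < s × c * r′ < s) ⊎ (s < c * r × s < c * r′) →
  (∀ l₀ → l ≡ just l₀ → (l₀ < r × l₀ < r′) ⊎ (r < l₀ × r′ < l₀)) →
  nbrIncreasing c s l (just r) ≡ nbrIncreasing c s l (just r′)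
nbrIncreasing-right-invariant c s nothing r r′ c≥1 (inj₁ (p , p′)) _ = same-value (<ᵇ-false (<⇒≤ p)) (<ᵇ-false (<⇒≤ p′))
nbrIncreasing-right-invariant c s nothing r r′ c≥1 (inj₂ (p , p′)) _ = same-value (<ᵇ-true p) (<ᵇ-true p′)
nbrIncreasing-right-invariant c s (just l) r r′ c≥1 (inj₁ (p , p′)) order with c * l <? s | order l refl
... | no q | _ = same-value (both-agree c s l r false (<ᵇ-false (≮⇒≥ q)) (<ᵇ-false (<⇒≤ p)))
                            (both-agree c s l r′ false (<ᵇ-false (≮⇒≥ q)) (<ᵇ-false (<⇒≤ p′)))
... | yes q | inj₂ (o , o′) =
  same-value (left-closer c s l r (closer-below (scale-< c c≥1 o) (<⇒≤ q)))
             (left-closer c s l r′ (closer-below (scale-< c c≥1 o′) (<⇒≤ q)))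
... | yes q | inj₁ (o , o′) =
  same-value (trans (right-closer c s l r (closer-below (scale-< c c≥1 o) (<⇒≤ p))) (<ᵇ-false (<⇒≤ p)))
             (trans (right-closer c s l r′ (closer-below (scale-< c c≥1 o′) (<⇒≤ p′))) (<ᵇ-false (<⇒≤ p′)))
nbrIncreasing-right-invariant c s (just l) r r′ c≥1 (inj₂ (p , p′)) order with c * l <? s | order l refl
... | yes q | _ = same-value (both-agree c s l r true (<ᵇ-true q) (<ᵇ-true p))
                             (both-agree c s l r′ true (<ᵇ-true q) (<ᵇ-true p′))
... | no q | inj₁ (o , o′) =
  same-value (left-closer c s l r (closer-above (≮⇒≥ q) (scale-< c c≥1 o)))
             (left-closer c s l r′ (closer-above (≮⇒≥ q) (scale-< c c≥1 o′)))
... | no q | inj₂ (o , o′) =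
  same-value (trans (right-closer c s l r (closer-above (<⇒≤ p) (scale-< c c≥1 o))) (<ᵇ-true p))
             (trans (right-closer c s l r′ (closer-above (<⇒≤ p′) (scale-< c c≥1 o′))) (<ᵇ-true p′))

nbrIncreasing-right-above : ∀ c s l r → 1 ≤ c → s < c * r →
  (∀ l₀ → l ≡ just l₀ → c * l₀ < s ⊎ r < l₀) → nbrIncreasing c s l (just r) ≡ true
nbrIncreasing-right-above c s nothing  r c≥1 above _     = <ᵇ-true above
nbrIncreasing-right-above c s (just l) r c≥1 above order with order l refl
... | inj₁ below = both-agree c s l r true (<ᵇ-true below) (<ᵇ-true above)
... | inj₂ r<l   = trans (right-closer c s l r (closer-above (<⇒≤ above) (scale-< c c≥1 r<l))) (<ᵇ-true above)

nbrIncreasing-left-below : ∀ c s l r → 1 ≤ c → c * l < s →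
  (∀ r₀ → r ≡ just r₀ → r₀ < l ⊎ s < c * r₀) → nbrIncreasing c s (just l) r ≡ true
nbrIncreasing-left-below c s l nothing  c≥1 below _     = <ᵇ-true below
nbrIncreasing-left-below c s l (just r) c≥1 below order with order r refl
... | inj₂ above = both-agree c s l r true (<ᵇ-true below) (<ᵇ-true above)
... | inj₁ r<l   = trans (left-closer c s l r (closer-below (scale-< c c≥1 r<l) (<⇒≤ below))) (<ᵇ-true below)

nbrIncreasing-right-below : ∀ c s l r → 1 ≤ c → c * r < s →
  (∀ l₀ → l ≡ just l₀ → l₀ < r ⊎ s < c * l₀) → nbrIncreasing c s l (just r) ≡ false
nbrIncreasing-right-below c s nothing  r c≥1 below _     = <ᵇ-false (<⇒≤ below)
nbrIncreasing-right-below c s (just l) r c≥1 below order with order l refl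
... | inj₂ above = both-agree c s l r false (<ᵇ-false (<⇒≤ above)) (<ᵇ-false (<⇒≤ below))
... | inj₁ l<r   = trans (right-closer c s l r (closer-below (scale-< c c≥1 l<r) (<⇒≤ below))) (<ᵇ-false (<⇒≤ below))

nbrIncreasing-left-above : ∀ c s l r → 1 ≤ c → s < c * l →
  (∀ r₀ → r ≡ just r₀ → l < r₀ ⊎ c * r₀ < s) → nbrIncreasing c s (just l) r ≡ false
nbrIncreasing-left-above c s l nothing  c≥1 above _     = <ᵇ-false (<⇒≤ above)
nbrIncreasing-left-above c s l (just r) c≥1 above order with order r refl
... | inj₂ below = both-agree c s l r false (<ᵇ-false (<⇒≤ above)) (<ᵇ-false (<⇒≤ below))
... | inj₁ l<r   = trans (left-closer c s l r (closer-above (<⇒≤ above) (scale-< c c≥1 l<r))) (<ᵇ-false (<⇒≤ above))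

rightPolarizedBy-proper : ∀ c len s l r → c < len → rightPolarizedBy c len s l r ≡ nbrIncreasing c s l r
rightPolarizedBy-proper c len s l r c<len rewrite dec-false (c ≟ len) (<⇒≢ c<len) = refl

-- c · b ≤ s ≤ c · (b + c - 1): the average s / c of c letters from b, …, b+c-1 lies in that interval.
SumWithin : ℕ → ℕ → ℕ → Set
SumWithin c b s = c * b ≤ s × s + c ≤ c * (b + c)

sum-within : ∀ b c (xs : Word) → length xs ≡ c → (∀ {x} → x ∈ xs → b ≤ x × x < b + c) → SumWithin c b (sum xs)
sum-within b c xs refl bounded = go xs bounded
  where
  go : ∀ (xs : Word) → (∀ {x} → x ∈ xs → b ≤ x × x < b + c) →
       length xs * b ≤ sum xs × sum xs + length xs ≤ length xs * (b + c)
  go []       _       = z≤n , z≤n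
  go (x ∷ xs) bounded with b≤x , x<b+c ← bounded (here refl) | lower , upper ← go xs (λ x∈ → bounded (there x∈)) =
    +-mono-≤ b≤x lower ,
    subst (_≤ (b + c) + length xs * (b + c)) (regroup x (sum xs) (length xs)) (+-mono-≤ x<b+c upper)
    where
    regroup : ∀ x s n → suc x + (s + n) ≡ x + s + suc n
    regroup x s n = trans (cong suc (sym (+-assoc x s n))) (sym (+-suc (x + s) n))

below-average : ∀ {c b s x} → SumWithin c b s → x < b → 1 ≤ c → c * x < s
below-average {c} (lower , _) x<b c≥1 = <-≤-trans (*-monoʳ-< c {{>-nonZero c≥1}} x<b) lower

above-average : ∀ {c b s x} → SumWithin c b s → b + c ≤ x → 1 ≤ c → s < c * x
above-average {c} {s = s} (_ , upper) b+c≤x c≥1 = <-≤-trans (m<m+n s c≥1) (≤-trans upper (*-monoʳ-≤ c b+c≤x))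

minW-LetterRange : ∀ {b c} (h : Word) → 1 ≤ c → LetterRange b c h → minW h ≡ b
minW-LetterRange {b} {c} []       c≥1 range with () ← LetterRange.complete range ≤-refl (m<m+n b c≥1)
minW-LetterRange {b} {c} (x ∷ xs) c≥1 range =
  ≤-antisym (foldr-⊓-≤ x xs (LetterRange.complete range ≤-refl (m<m+n b c≥1)))
            (proj₁ (LetterRange.bounded range (foldr-⊓-∈ x xs)))
  where
  foldr-⊓-≤ : ∀ x (xs : Word) {y} → y ∈ x ∷ xs → foldr _⊓_ x xs ≤ y
  foldr-⊓-≤ x []       (here refl)         = ≤-refl
  foldr-⊓-≤ x (z ∷ xs) (here refl)         = ≤-trans (m⊓n≤n z _) (foldr-⊓-≤ x xs (here refl))
  foldr-⊓-≤ x (z ∷ xs) (there (here refl)) = m⊓n≤m z _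
  foldr-⊓-≤ x (z ∷ xs) (there (there y∈))  = ≤-trans (m⊓n≤n z _) (foldr-⊓-≤ x xs (there y∈))

  foldr-⊓-∈ : ∀ x (xs : Word) → foldr _⊓_ x xs ∈ x ∷ xs
  foldr-⊓-∈ x []       = here refl
  foldr-⊓-∈ x (z ∷ xs) with ⊓-sel z (foldr _⊓_ x xs)
  ... | inj₁ eq = subst (_∈ x ∷ z ∷ xs) (sym eq) (there (here refl))
  ... | inj₂ eq with foldr-⊓-∈ x xs
  ...   | here  e   = subst (_∈ x ∷ z ∷ xs) (sym eq) (here e)
  ...   | there y∈ = subst (_∈ x ∷ z ∷ xs) (sym eq) (there (there y∈))

private
  suc-+-pred : ∀ k {b} → 1 ≤ b → suc k + (b ∸ 1) ≡ k + b
  suc-+-pred k {b} b≥1 = trans (sym (+-suc k (b ∸ 1))) (cong (k +_) (m+[n∸m]≡n b≥1))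

rearrangement-bounded : ∀ {b c} (h u′ : Word) → 1 ≤ b → 1 ≤ c → LetterRange b c h → IsPerm c u′ →
  ∀ {x} → x ∈ rearrangement h u′ → b ≤ x × x < b + c
rearrangement-bounded {b} {c} h u′ b≥1 c≥1 range u′↭ x∈
  with t , t∈ , refl ← ∈-map⁻ _ x∈ with k , k<c , refl ← ∈-perm⁻ u′↭ t∈
  rewrite minW-LetterRange h c≥1 range | suc-+-pred k b≥1 =
  m≤n+m b k , subst (_< b + c) (+-comm b k) (+-monoʳ-< b k<c)

backwardBy-nbr-cong : ∀ c len (h : Word) l r l′ r′ →
  nbrIncreasing c (sum h) l r ≡ nbrIncreasing c (sum h) l′ r′ → backwardBy c len h l r ≡ backwardBy c len h l′ r′
backwardBy-nbr-cong c len h l r l′ r′ same = cong (λ rp → (rp ∧ leftLeaning h) ∨ (not rp ∧ rightLeaning h) ∨ omniLeaning h)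
                                        (cong (if c ≡ᵇ len then false else_) same)

-- The hypothesis covers every sum in the range because the rearrangements of h, whose
-- polarization enters `rearrangesForwardBy`, have other sums in that same range.
badBy-nbr-invariant : ∀ c P C len (h : Word) l r l′ r′ {b} → 1 ≤ c → All (All (IsPerm c)) P → 1 ≤ b →
  LetterRange b c h → length h ≡ c →
  (∀ s → SumWithin c b s → nbrIncreasing c s l r ≡ nbrIncreasing c s l′ r′) →
  badBy c P C len h l r ≡ badBy c P C len h l′ r′
badBy-nbr-invariant c P C len h l r l′ r′ {b} c≥1 parts b≥1 range |h|≡c same =
  cong₂ (λ bw rf → any (formsIn h) P ∧ bw ∧ not (any (formsIn h) P ∧ formsIn h C ∧ (not bw ∨ (bw ∧ not rf))))
        backward-same rearranges-same
  where
  backward-same : backwardBy c len h l r ≡ backwardBy c len h l′ r′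
  backward-same = backwardBy-nbr-cong c len h l r l′ r′ (same (sum h) (sum-within b c h |h|≡c (LetterRange.bounded range)))

  rearranges-same : rearrangesForwardBy c P len h l r ≡ rearrangesForwardBy c P len h l′ r′
  rearranges-same = any-cong P λ {p} p∈ → cong (formsIn h p ∧_) (any-cong p λ {u′} u′∈ →
    let u′↭ = All.lookup (All.lookup parts p∈) u′∈
        X = rearrangement h u′
    in cong not (backwardBy-nbr-cong c len X l r l′ r′ (same (sum X)
         (sum-within b c X (trans (length-map _ u′) (length-perm u′↭)) (rearrangement-bounded h u′ b≥1 c≥1 range u′↭)))))

module _ {c : ℕ} {v : Word} {j b : ℕ} (range : LetterRange b c (sub c v j)) where

  inside-window : ∀ {q x} → j ≤ q → q < j + c → nth v q ≡ just x → b ≤ x × x < b + c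
  inside-window j≤q q<j+c e with t , refl ← m≤n⇒∃[o]m+o≡n j≤q =
    LetterRange.bounded range (nth⇒∈sub c v j (+-cancelˡ-< j t c q<j+c) e)

  outside-window : Unique v → ∀ {q x} → nth v q ≡ just x → q < j ⊎ j + c ≤ q → x < b ⊎ b + c ≤ x
  outside-window uniq {q} {x} e q-outside with b ≤? x | x <? b + c
  ... | no  b≰x | _         = inj₁ (≰⇒> b≰x)
  ... | yes _   | no  x≮b+c = inj₂ (≮⇒≥ x≮b+c)
  ... | yes b≤x | yes x<b+c with t , t<c , e′ ← ∈sub⇒nth c v j (LetterRange.complete range b≤x x<b+c)
    with refl ← nth-injective v uniq q (j + t) e e′ with q-outside
  ...   | inj₁ j+t<j   = ⊥-elim (<⇒≱ j+t<j (m≤m+n j t))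
  ...   | inj₂ j+c≤j+t = ⊥-elim (<⇒≱ (+-monoʳ-< j t<c) j+c≤j+t)

nonoverlapping-ranges : ∀ {c v i j a b} → 1 ≤ c → Unique v →
  LetterRange a c (sub c v i) → LetterRange b c (sub c v j) → i + c ≤ j ⊎ j + c ≤ i → a + c ≤ b ⊎ b + c ≤ a
nonoverlapping-ranges {c} {v} {i} {j} {a} {b} c≥1 uniq rangeA rangeB apart
  with t , t<c , eb ← ∈sub⇒nth c v j (LetterRange.complete rangeB ≤-refl (m<m+n b c≥1))
  with outside-window rangeA uniq eb (side apart)
  where
  side : i + c ≤ j ⊎ j + c ≤ i → j + t < i ⊎ i + c ≤ j + t
  side (inj₁ i+c≤j) = inj₂ (≤-trans i+c≤j (m≤m+n j t))
  side (inj₂ j+c≤i) = inj₁ (<-≤-trans (+-monoʳ-< j t<c) j+c≤i)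
... | inj₂ a+c≤b = inj₁ a+c≤b
... | inj₁ b<a with t′ , t′<c , ea ← ∈sub⇒nth c v i (LetterRange.complete rangeA ≤-refl (m<m+n a c≥1))
  with outside-window rangeB uniq ea (side′ apart)
  where
  side′ : i + c ≤ j ⊎ j + c ≤ i → i + t′ < j ⊎ j + c ≤ i + t′
  side′ (inj₁ i+c≤j) = inj₁ (<-≤-trans (+-monoʳ-< i t′<c) i+c≤j)
  side′ (inj₂ j+c≤i) = inj₂ (≤-trans j+c≤i (m≤m+n i t′))
...   | inj₁ a<b   = ⊥-elim (<-asym a<b b<a)
...   | inj₂ b+c≤a = inj₂ b+c≤a

module _ {c : ℕ} {v : Word} {j p m : ℕ} (j<p : j < p) (p<j+c : p < j + c) (j+c≤n : j + c ≤ length v) where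

  private
    |h|≡c : length (sub c v j) ≡ c
    |h|≡c = length-sub c v j j+c≤n

    0<|h| : 0 < length (sub c v j)
    0<|h| = subst (0 <_) (sym |h|≡c) (+-cancelˡ-< j 0 c (subst (_< j + c) (sym (+-identityʳ j)) (<-trans j<p p<j+c)))

    k<|h| : p ∸ j < length (sub c v j)
    k<|h| = subst (p ∸ j <_) (trans (m+n∸m≡n j c) (sym |h|≡c)) (∸-monoˡ-< p<j+c (<⇒≤ j<p))

    j+k≡p : j + (p ∸ j) ≡ p
    j+k≡p = m+[n∸m]≡n (<⇒≤ j<p)

    absolute : ∀ {t x} → nth (sub c v j) t ≡ just x → t < c × nth v (j + t) ≡ just x
    absolute {t} e with t<c ← subst (t <_) |h|≡c (nth-just⇒< (sub c v j) t e) = t<c , trans (sym (nth-sub c v j t<c)) e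

    first : ∀ {x} → nth (sub c v j) 0 ≡ just x → j ≤ j + 0 × j + 0 < p × nth v (j + 0) ≡ just x
    first e = m≤m+n j 0 , subst (_< p) (sym (+-identityʳ j)) j<p , proj₂ (absolute e)

    last : ∀ {z} → nth (sub c v j) (length (sub c v j) ∸ 1) ≡ just z →
           p ≤ j + (c ∸ 1) × j + (c ∸ 1) < j + c × nth v (j + (c ∸ 1)) ≡ just z
    last e with c-1<c , e′ ← absolute (subst (λ n → nth (sub c v j) (n ∸ 1) ≡ just _) |h|≡c e) =
      ≤-pred (subst (p <_) (trans (cong (j +_) (sym (m+[n∸m]≡n (≤-<-trans z≤n c-1<c)))) (+-suc j (c ∸ 1))) p<j+c) ,
      +-monoʳ-< j c-1<c , e′

    split : ∀ {t t′ x y} → t < p ∸ j → p ∸ j ≤ t′ → nth (sub c v j) t ≡ just x → nth (sub c v j) t′ ≡ just y →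
            (j ≤ j + t × j + t < p × nth v (j + t) ≡ just x) × (p ≤ j + t′ × j + t′ < j + c × nth v (j + t′) ≡ just y)
    split {t} {t′} t<k k≤t′ ex ey with _ , ex′ ← absolute ex | t′<c , ey′ ← absolute ey =
      (m≤m+n j t , subst (j + t <_) j+k≡p (+-monoʳ-< j t<k) , ex′) ,
      (subst (_≤ j + t′) j+k≡p (+-monoʳ-≤ j k≤t′) , +-monoʳ-< j t′<c , ey′)

  rising-window : (∀ {q x} → j ≤ q → q < p → nth v q ≡ just x → x < m) →
                  (∀ {q x} → p ≤ q → q < j + c → nth v q ≡ just x → m ≤ x) →
                  rightLeaning (sub c v j) ≡ true × leftLeaning (sub c v j) ≡ false
  rising-window lower upper =
    rightLeaning-split (sub c v j) (p ∸ j) (m<n⇒0<n∸m j<p) k<|h|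
      (λ t<k k≤t′ ex ey → let (j≤q , q<p , ex′) , (p≤q′ , q′<j+c , ey′) = split t<k k≤t′ ex ey
                          in <-≤-trans (lower j≤q q<p ex′) (upper p≤q′ q′<j+c ey′)) ,
    leftLeaning-first≤last (sub c v j) 0<|h|
      (λ ex ez → let j≤q , q<p , ex′ = first ex ; p≤q′ , q′<j+c , ez′ = last ez
                 in <⇒≤ (<-≤-trans (lower j≤q q<p ex′) (upper p≤q′ q′<j+c ez′)))

  falling-window : (∀ {q x} → j ≤ q → q < p → nth v q ≡ just x → m ≤ x) →
                   (∀ {q x} → p ≤ q → q < j + c → nth v q ≡ just x → x < m) →
                   leftLeaning (sub c v j) ≡ true × rightLeaning (sub c v j) ≡ false
  falling-window upper lower =
    leftLeaning-split (sub c v j) (p ∸ j) (m<n⇒0<n∸m j<p) k<|h|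
      (λ k≤t t′<k ex ey → let (j≤q , q<p , ey′) , (p≤q′ , q′<j+c , ex′) = split t′<k k≤t ey ex
                          in <-≤-trans (lower p≤q′ q′<j+c ex′) (upper j≤q q<p ey′)) ,
    rightLeaning-last≤first (sub c v j) 0<|h|
      (λ ex ez → let j≤q , q<p , ex′ = first ex ; p≤q′ , q′<j+c , ez′ = last ez
                 in <⇒≤ (<-≤-trans (lower p≤q′ q′<j+c ez′) (upper j≤q q<p ex′)))

module _ {c : ℕ} {v : Word} {j a : ℕ} (c≥1 : 1 ≤ c) (c<n : c < length v) (j+c≤n : j + c ≤ length v)
         (range : LetterRange a c (sub c v j)) where

  private
    s = sum (sub c v j)

    within : SumWithin c a s
    within = sum-within a c (sub c v j) (length-sub c v j j+c≤n) (LetterRange.bounded range)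

    polarity : rightPolarized c v j ≡ nbrIncreasing c s (leftNbr v j) (rightNbr c v j)
    polarity = trans (rightPolarized-local c v j) (rightPolarizedBy-proper c (length v) s (leftNbr v j) (rightNbr c v j) c<n)

    below : ∀ {x} → x < a → c * x < s
    below x<a = below-average within x<a c≥1

    above : ∀ {x} → a + c ≤ x → s < c * x
    above a+c≤x = above-average within a+c≤x c≥1

  rightPolarized-rightNbr-above : ∀ {z} → rightNbr c v j ≡ just z → a + c ≤ z →
    (∀ l → leftNbr v j ≡ just l → l < a ⊎ z < l) → rightPolarized c v j ≡ true
  rightPolarized-rightNbr-above {z} er a+c≤z order rewrite polarity | er =
    nbrIncreasing-right-above c s (leftNbr v j) z c≥1 (above a+c≤z)
      λ l el → map₁ below (order l el)

  rightPolarized-leftNbr-below : ∀ {l} → leftNbr v j ≡ just l → l < a →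
    (∀ r → rightNbr c v j ≡ just r → r < l ⊎ a + c ≤ r) → rightPolarized c v j ≡ true
  rightPolarized-leftNbr-below {l} el l<a order rewrite polarity | el =
    nbrIncreasing-left-below c s l (rightNbr c v j) c≥1 (below l<a)
      λ r er → map₂ above (order r er)

  leftPolarized-rightNbr-below : ∀ {z} → rightNbr c v j ≡ just z → z < a →
    (∀ l → leftNbr v j ≡ just l → l < z ⊎ a + c ≤ l) → rightPolarized c v j ≡ false
  leftPolarized-rightNbr-below {z} er z<a order rewrite polarity | er =
    nbrIncreasing-right-below c s (leftNbr v j) z c≥1 (below z<a)
      λ l el → map₂ above (order l el)

  leftPolarized-leftNbr-above : ∀ {l} → leftNbr v j ≡ just l → a + c ≤ l →
    (∀ r → rightNbr c v j ≡ just r → l < r ⊎ r < a) → rightPolarized c v j ≡ false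
  leftPolarized-leftNbr-above {l} el a+c≤l order rewrite polarity | el =
    nbrIncreasing-left-above c s l (rightNbr c v j) c≥1 (above a+c≤l)
      λ r er → map₂ below (order r er)

forward-rightPolarized : ∀ c w i → rightPolarized c w i ≡ true →
  rightLeaning (sub c w i) ≡ true → leftLeaning (sub c w i) ≡ false → backward c w i ≡ false
forward-rightPolarized c w i rp rl ll rewrite rp | rl | ll = refl

forward-leftPolarized : ∀ c w i → rightPolarized c w i ≡ false →
  leftLeaning (sub c w i) ≡ true → rightLeaning (sub c w i) ≡ false → backward c w i ≡ false
forward-leftPolarized c w i rp ll rl rewrite rp | rl | ll = refl

-- Overlapping hits are forward

leftNbr-position : ∀ (w : Word) j {o} → leftNbr w j ≡ just o → ∃[ q ] suc q ≡ j × nth w q ≡ just o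
leftNbr-position w (suc q) e = q , refl , e

module _ {c : ℕ} {v : Word} {j d a b : ℕ} (c≥1 : 1 ≤ c) (uniq : Unique v) (d≥1 : 1 ≤ d) (d<c : d < c)
         (fits : j + d + c ≤ length v)
         (rangeA : LetterRange a c (sub c v j)) (rangeB : LetterRange b c (sub c v (j + d))) where

  private
    j+d<j+c : j + d < j + c
    j+d<j+c = +-monoʳ-< j d<c

    j<j+d : j < j + d
    j<j+d = m<m+n j d≥1

    j+c<j+d+c : j + c < j + d + c
    j+c<j+d+c = +-monoˡ-< c j<j+d

    j+c≤n : j + c ≤ length v
    j+c≤n = ≤-trans (<⇒≤ j+c<j+d+c) fits

    c<n : c < length v
    c<n = <-≤-trans (≤-<-trans (m≤n+m c j) j+c<j+d+c) fits

    value : ∀ q → q < length v → ∃[ x ] nth v q ≡ just x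
    value = <⇒nth-just v

    inA : ∀ {q x} → j ≤ q → q < j + c → nth v q ≡ just x → a ≤ x × x < a + c
    inA = inside-window rangeA

    inB : ∀ {q x} → j + d ≤ q → q < j + d + c → nth v q ≡ just x → b ≤ x × x < b + c
    inB = inside-window rangeB

    outA : ∀ {q x} → nth v q ≡ just x → q < j ⊎ j + c ≤ q → x < a ⊎ a + c ≤ x
    outA = outside-window rangeA uniq

    outB : ∀ {q x} → nth v q ≡ just x → q < j + d ⊎ j + d + c ≤ q → x < b ⊎ b + c ≤ x
    outB = outside-window rangeB uniq

    -- X = [j, j+d), Y = [j+d, j+c) and Z = [j+c, j+d+c) are the positions of the first hit only,
    -- of both hits, and of the second hit only.
    X-A : ∀ {q x} → j ≤ q → q < j + d → nth v q ≡ just x → a ≤ x × x < a + c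
    X-A j≤q q<j+d = inA j≤q (<-trans q<j+d j+d<j+c)

    Y-A : ∀ {q x} → j + d ≤ q → q < j + c → nth v q ≡ just x → a ≤ x × x < a + c
    Y-A j+d≤q = inA (≤-trans (<⇒≤ j<j+d) j+d≤q)

    Y-B : ∀ {q x} → j + d ≤ q → q < j + c → nth v q ≡ just x → b ≤ x × x < b + c
    Y-B j+d≤q q<j+c = inB j+d≤q (<-trans q<j+c j+c<j+d+c)

    Z-B : ∀ {q x} → j + c ≤ q → q < j + d + c → nth v q ≡ just x → b ≤ x × x < b + c
    Z-B j+c≤q = inB (≤-trans (<⇒≤ j+d<j+c) j+c≤q)

    first : ∃[ x ] nth v j ≡ just x
    first = value j (<-≤-trans j<j+d (≤-trans (<⇒≤ j+d<j+c) j+c≤n))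

    a≢b : a ≢ b
    a≢b refl with x , ex ← first with X-A ≤-refl j<j+d ex | outB ex (inj₁ j<j+d)
    ... | a≤x , _ | inj₁ x<a   = <⇒≱ x<a a≤x
    ... | _ , x<a+c | inj₂ a+c≤x = <⇒≱ x<a+c a+c≤x

    shared : ∃[ y ] nth v (j + d) ≡ just y
    shared = value (j + d) (<-≤-trans j+d<j+c j+c≤n)

    b<a+c : b < a + c
    b<a+c with y , ey ← shared = ≤-<-trans (proj₁ (Y-B ≤-refl j+d<j+c ey)) (proj₂ (Y-A ≤-refl j+d<j+c ey))

    a<b+c : a < b + c
    a<b+c with y , ey ← shared = ≤-<-trans (proj₁ (Y-A ≤-refl j+d<j+c ey)) (proj₂ (Y-B ≤-refl j+d<j+c ey))

    outside-both : ∀ {q x} → nth v q ≡ just x → q < j ⊎ j + d + c ≤ q → (x < a ⊎ a + c ≤ x) × (x < b ⊎ b + c ≤ x)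
    outside-both ex (inj₁ q<j)     = outA ex (inj₁ q<j) , outB ex (inj₁ (<-trans q<j j<j+d))
    outside-both ex (inj₂ j+d+c≤q) = outA ex (inj₂ (≤-trans (<⇒≤ j+c<j+d+c) j+d+c≤q)) , outB ex (inj₂ j+d+c≤q)

    rightNbr₁ : ∃[ z ] rightNbr c v j ≡ just z
    rightNbr₁ = value (j + c) (<-≤-trans j+c<j+d+c fits)

    last-of-X : j + d ≡ suc (j + (d ∸ 1))
    last-of-X = trans (cong (j +_) (sym (m+[n∸m]≡n d≥1))) (+-suc j (d ∸ 1))

    last-of-X<j+d : j + (d ∸ 1) < j + d
    last-of-X<j+d = subst (j + (d ∸ 1) <_) (sym last-of-X) ≤-refl

    leftNbr₂ : ∃[ l ] leftNbr v (j + d) ≡ just l × j ≤ j + (d ∸ 1) × j + (d ∸ 1) < j + d × nth v (j + (d ∸ 1)) ≡ just l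
    leftNbr₂ with l , el ← value (j + (d ∸ 1)) (<-trans last-of-X<j+d (<-≤-trans j+d<j+c j+c≤n)) =
      l , trans (cong (leftNbr v) last-of-X) el , m≤m+n j (d ∸ 1) , last-of-X<j+d , el

    -- If a < b the letters rise from X through Y to Z, so both hits are right leaning and right
    -- polarized; if b < a they fall and both hits are left leaning and left polarized.
    module Ascending (a<b : a < b) where
      X<b : ∀ {q x} → j ≤ q → q < j + d → nth v q ≡ just x → x < b
      X<b j≤q q<j+d ex with outB ex (inj₁ q<j+d)
      ... | inj₁ x<b   = x<b
      ... | inj₂ b+c≤x = ⊥-elim (<⇒≱ (<-trans (proj₂ (X-A j≤q q<j+d ex)) (+-monoˡ-< c a<b)) b+c≤x)

      Z≥a+c : ∀ {q x} → j + c ≤ q → q < j + d + c → nth v q ≡ just x → a + c ≤ x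
      Z≥a+c j+c≤q q<j+d+c ex with outA ex (inj₂ j+c≤q)
      ... | inj₂ a+c≤x = a+c≤x
      ... | inj₁ x<a   = ⊥-elim (<⇒≱ (<-trans x<a a<b) (proj₁ (Z-B j+c≤q q<j+d+c ex)))

      outside : ∀ {q x} → nth v q ≡ just x → q < j ⊎ j + d + c ≤ q → x < a ⊎ b + c ≤ x
      outside ex q-outside with outside-both ex q-outside
      ... | inj₁ x<a   , _          = inj₁ x<a
      ... | inj₂ _     , inj₂ b+c≤x = inj₂ b+c≤x
      ... | inj₂ a+c≤x , inj₁ x<b   = ⊥-elim (<-irrefl refl (<-trans b<a+c (≤-<-trans a+c≤x x<b)))

      hit₁ : backward c v j ≡ false
      hit₁ with z , ez ← rightNbr₁
        with rl , ll ← rising-window {m = b} j<j+d j+d<j+c j+c≤n X<b (λ p≤q q<j+c → proj₁ ∘ Y-B p≤q q<j+c) =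
        forward-rightPolarized c v j
          (rightPolarized-rightNbr-above c≥1 c<n j+c≤n rangeA ez (Z≥a+c ≤-refl j+c<j+d+c ez) left-order) rl ll
        where
        left-order : ∀ l → leftNbr v j ≡ just l → l < a ⊎ z < l
        left-order l el with q , refl , eq ← leftNbr-position v j el with outside eq (inj₁ ≤-refl)
        ... | inj₁ l<a   = inj₁ l<a
        ... | inj₂ b+c≤l = inj₂ (<-≤-trans (proj₂ (Z-B ≤-refl j+c<j+d+c ez)) b+c≤l)

      hit₂ : backward c v (j + d) ≡ false
      hit₂ with l , el , j≤q , q<j+d , eq ← leftNbr₂
        with rl , ll ← rising-window {m = a + c} j+d<j+c j+c<j+d+c fits (λ p≤q q<j+c → proj₂ ∘ Y-A p≤q q<j+c) Z≥a+c =
        forward-rightPolarized c v (j + d)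
          (rightPolarized-leftNbr-below c≥1 c<n fits rangeB el (X<b j≤q q<j+d eq) right-order) rl ll
        where
        right-order : ∀ r → rightNbr c v (j + d) ≡ just r → r < l ⊎ b + c ≤ r
        right-order r er with outside er (inj₂ ≤-refl)
        ... | inj₁ r<a   = inj₁ (<-≤-trans r<a (proj₁ (X-A j≤q q<j+d eq)))
        ... | inj₂ b+c≤r = inj₂ b+c≤r

    module Descending (b<a : b < a) where
      X≥b+c : ∀ {q x} → j ≤ q → q < j + d → nth v q ≡ just x → b + c ≤ x
      X≥b+c j≤q q<j+d ex with outB ex (inj₁ q<j+d)
      ... | inj₂ b+c≤x = b+c≤x
      ... | inj₁ x<b   = ⊥-elim (<⇒≱ (<-trans x<b b<a) (proj₁ (X-A j≤q q<j+d ex)))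

      Z<a : ∀ {q x} → j + c ≤ q → q < j + d + c → nth v q ≡ just x → x < a
      Z<a j+c≤q q<j+d+c ex with outA ex (inj₂ j+c≤q)
      ... | inj₁ x<a   = x<a
      ... | inj₂ a+c≤x = ⊥-elim (<⇒≱ (<-trans (proj₂ (Z-B j+c≤q q<j+d+c ex)) (+-monoˡ-< c b<a)) a+c≤x)

      outside : ∀ {q x} → nth v q ≡ just x → q < j ⊎ j + d + c ≤ q → x < b ⊎ a + c ≤ x
      outside ex q-outside with outside-both ex q-outside
      ... | inj₂ a+c≤x , _          = inj₂ a+c≤x
      ... | inj₁ _     , inj₁ x<b   = inj₁ x<b
      ... | inj₁ x<a   , inj₂ b+c≤x = ⊥-elim (<-irrefl refl (<-trans a<b+c (≤-<-trans b+c≤x x<a)))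

      hit₁ : backward c v j ≡ false
      hit₁ with z , ez ← rightNbr₁
        with ll , rl ← falling-window {m = b + c} j<j+d j+d<j+c j+c≤n X≥b+c (λ p≤q q<j+c → proj₂ ∘ Y-B p≤q q<j+c) =
        forward-leftPolarized c v j
          (leftPolarized-rightNbr-below c≥1 c<n j+c≤n rangeA ez (Z<a ≤-refl j+c<j+d+c ez) left-order) ll rl
        where
        left-order : ∀ l → leftNbr v j ≡ just l → l < z ⊎ a + c ≤ l
        left-order l el with q , refl , eq ← leftNbr-position v j el with outside eq (inj₁ ≤-refl)
        ... | inj₁ l<b   = inj₁ (<-≤-trans l<b (proj₁ (Z-B ≤-refl j+c<j+d+c ez)))
        ... | inj₂ a+c≤l = inj₂ a+c≤l

      hit₂ : backward c v (j + d) ≡ false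
      hit₂ with l , el , j≤q , q<j+d , eq ← leftNbr₂
        with ll , rl ← falling-window {m = a} j+d<j+c j+c<j+d+c fits (λ p≤q q<j+c → proj₁ ∘ Y-A p≤q q<j+c) Z<a =
        forward-leftPolarized c v (j + d)
          (leftPolarized-leftNbr-above c≥1 c<n fits rangeB el (X≥b+c j≤q q<j+d eq) right-order) ll rl
        where
        right-order : ∀ r → rightNbr c v (j + d) ≡ just r → l < r ⊎ r < b
        right-order r er with outside er (inj₂ ≤-refl)
        ... | inj₁ r<b   = inj₂ r<b
        ... | inj₂ a+c≤r = inj₁ (<-≤-trans (proj₂ (X-A j≤q q<j+d eq)) a+c≤r)

  overlapping-hits-forward : backward c v j ≡ false × backward c v (j + d) ≡ false
  overlapping-hits-forward with <-cmp a b
  ... | tri< a<b _ _ = Ascending.hit₁ a<b , Ascending.hit₂ a<b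
  ... | tri≈ _ a≡b _ = ⊥-elim (a≢b a≡b)
  ... | tri> _ _ b<a = Descending.hit₁ b<a , Descending.hit₂ b<a

DistinctPositive : Word → Set
DistinctPositive v = Unique v × (∀ {x} → x ∈ v → 1 ≤ x)

IsPerm⇒DistinctPositive : ∀ n {w : Word} → IsPerm n w → DistinctPositive w
IsPerm⇒DistinctPositive n w↭ =
  PermutationSetoid.Unique-resp-↭ (setoid ℕ) (↭⇒↭ₛ (↭-sym w↭)) (Unique.map⁺ suc-injective (Unique.upTo⁺ n)) ,
  λ x∈ → let _ , _ , x≡1+k = ∈-map⁻ suc (∈-resp-↭ w↭ x∈) in subst (1 ≤_) (sym x≡1+k) (s≤s z≤n)

DistinctPositive-resp-↭ : ∀ {v v′ : Word} → v ↭ v′ → DistinctPositive v → DistinctPositive v′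
DistinctPositive-resp-↭ v↭ (uniq , positive) =
  PermutationSetoid.Unique-resp-↭ (setoid ℕ) (↭⇒↭ₛ v↭) uniq , λ x∈ → positive (∈-resp-↭ (↭-sym v↭) x∈)

hit-range : ∀ {c U} {v : Word} j → 1 ≤ c → All (All (IsPerm c)) U → DistinctPositive v →
  any (formsIn (sub c v j)) U ≡ true → ∃[ b ] 1 ≤ b × LetterRange b c (sub c v j)
hit-range {c} {U} {v} j c≥1 parts (_ , positive) hit
  with p , p∈ , formsIn-p ← any-true⁻ _ U hit with u , u∈ , forms-u ← any-true⁻ _ p formsIn-p =
  forms⇒LetterRange c≥1 (All.lookup (All.lookup parts p∈) u∈) forms-u
    λ x∈ → let t , _ , e = ∈sub⇒nth c v j x∈ in positive (nth⇒∈ v (j + t) e)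

private
  gap-positive : ∀ {i d} → i < i + d → 1 ≤ d
  gap-positive {i} {zero}  i<i+0 = ⊥-elim (<-irrefl (sym (+-identityʳ i)) i<i+0)
  gap-positive {i} {suc d} _     = s≤s z≤n

bad-if-not-hit : ∀ c P C (v : Word) j → isPHit c P v j ≡ false → bad c P C v j ≡ false
bad-if-not-hit c P C v j no-hit rewrite no-hit = refl

countB-cong : ∀ {A : Set} (f g : A → Bool) (xs : List A) → (∀ {x} → x ∈ xs → f x ≡ g x) → countB f xs ≡ countB g xs
countB-cong f g []       _     = refl
countB-cong f g (x ∷ xs) f≡g rewrite f≡g (here refl) with g x
... | true  = cong suc (countB-cong f g xs (λ x∈ → f≡g (there x∈)))
... | false = countB-cong f g xs (λ x∈ → f≡g (there x∈))

countB-except-one : ∀ {A : Set} (f g : A → Bool) (xs : List A) {i} → Unique xs → i ∈ xs → f i ≡ true → g i ≡ false →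
  (∀ {x} → x ∈ xs → x ≢ i → f x ≡ g x) → countB f xs ≡ suc (countB g xs)
countB-except-one f g (x ∷ xs) (x∉ ∷ _) (here refl) fi gi agree rewrite fi | gi =
  cong suc (countB-cong f g xs λ y∈ → agree (there y∈) (λ { refl → All.lookup x∉ y∈ refl }))
countB-except-one f g (x ∷ xs) (x∉ ∷ uniq) (there i∈) fi gi agree
  rewrite agree (here refl) (All.lookup x∉ i∈) with g x
... | true  = cong suc (countB-except-one f g xs uniq i∈ fi gi (λ y∈ → agree (there y∈)))
... | false = countB-except-one f g xs uniq i∈ fi gi (λ y∈ → agree (there y∈))

bad-beyond-end : ∀ c P C (v : Word) j → ¬ (j + c ≤ length v) → bad c P C v j ≡ false
bad-beyond-end c P C v j j+c≰n rewrite dec-false (j + c ≤? length v) j+c≰n = refl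

bad-if-forward : ∀ c P C (v : Word) j → backward c v j ≡ false → bad c P C v j ≡ false
bad-if-forward c P C v j fw rewrite fw = ∧-zeroʳ (isPHit c P v j)

bad-if-straightened : ∀ c P C (v : Word) j → straightened c P C v j ≡ true → bad c P C v j ≡ false
bad-if-straightened c P C v j st rewrite st | ∧-zeroʳ (backward c v j) = ∧-zeroʳ (isPHit c P v j)

module _ {c : ℕ} {U : List (List Word)} (D : List Word) (c≥1 : 1 ≤ c) (parts : All (All (IsPerm c)) U) where

  not-bad-unless-hit : ∀ (v : Word) j → DistinctPositive v →
    (j + c ≤ length v → ∀ {b} → LetterRange b c (sub c v j) → bad c U D v j ≡ false) → bad c U D v j ≡ false
  not-bad-unless-hit v j good not-bad with j + c ≤? length v
  ... | no  j+c≰n = bad-beyond-end c U D v j j+c≰n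
  ... | yes j+c≤n = by-cases (any (formsIn (sub c v j)) U) refl
    where
    by-cases : ∀ hit? → any (formsIn (sub c v j)) U ≡ hit? → bad c U D v j ≡ false
    by-cases false no-hit = bad-if-not-hit c U D v j (trans (isPHit-local c U v j j+c≤n) no-hit)
    by-cases true  is-hit with _ , _ , range ← hit-range j c≥1 parts good is-hit = not-bad j+c≤n range

  overlapping-not-bad : ∀ (v : Word) i j {a} → DistinctPositive v → i + c ≤ length v → LetterRange a c (sub c v i) →
    (i < j × j < i + c) ⊎ (j < i × i < j + c) → bad c U D v j ≡ false
  overlapping-not-bad v i j good@(uniq , _) i+c≤n rangeA overlapping = not-bad-unless-hit v j good λ j+c≤n rangeB →
    bad-if-forward c U D v j (not-backward overlapping j+c≤n rangeB)
    where
    not-backward : ∀ {b} → (i < j × j < i + c) ⊎ (j < i × i < j + c) → j + c ≤ length v → LetterRange b c (sub c v j) →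
                   backward c v j ≡ false
    not-backward (inj₁ (i<j , j<i+c)) j+c≤n rangeB with d , refl ← m≤n⇒∃[o]m+o≡n (<⇒≤ i<j) =
      proj₂ (overlapping-hits-forward c≥1 uniq (gap-positive i<j) (+-cancelˡ-< i d c j<i+c) j+c≤n rangeA rangeB)
    not-backward (inj₂ (j<i , i<j+c)) j+c≤n rangeB with d , refl ← m≤n⇒∃[o]m+o≡n (<⇒≤ j<i) =
      proj₁ (overlapping-hits-forward c≥1 uniq (gap-positive j<i) (+-cancelˡ-< j d c i<j+c) i+c≤n rangeB rangeA)

  private
    same-side-of-average : ∀ {a b s x x′} → a + c ≤ b ⊎ b + c ≤ a → SumWithin c b s →
      a ≤ x × x < a + c → a ≤ x′ × x′ < a + c → (c * x < s × c * x′ < s) ⊎ (s < c * x × s < c * x′)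
    same-side-of-average (inj₁ a+c≤b) within (_ , x<a+c) (_ , x′<a+c) =
      inj₁ (below-average within (<-≤-trans x<a+c a+c≤b) c≥1 , below-average within (<-≤-trans x′<a+c a+c≤b) c≥1)
    same-side-of-average (inj₂ b+c≤a) within (a≤x , _) (a≤x′ , _) =
      inj₂ (above-average within (≤-trans b+c≤a a≤x) c≥1 , above-average within (≤-trans b+c≤a a≤x′) c≥1)

    same-side-of-letters : ∀ {a o x x′} → o < a ⊎ a + c ≤ o → a ≤ x × x < a + c → a ≤ x′ × x′ < a + c →
      (o < x × o < x′) ⊎ (x < o × x′ < o)
    same-side-of-letters (inj₁ o<a)   (a≤x , _)   (a≤x′ , _)   = inj₁ (<-≤-trans o<a a≤x , <-≤-trans o<a a≤x′)
    same-side-of-letters (inj₂ a+c≤o) (_ , x<a+c) (_ , x′<a+c) = inj₂ (<-≤-trans x<a+c a+c≤o , <-≤-trans x′<a+c a+c≤o)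

  badBy-rightNbr-swap : ∀ len (h : Word) l {x x′ a b} → 1 ≤ b → LetterRange b c h → length h ≡ c →
    a + c ≤ b ⊎ b + c ≤ a → a ≤ x × x < a + c → a ≤ x′ × x′ < a + c →
    (∀ l₀ → l ≡ just l₀ → l₀ < a ⊎ a + c ≤ l₀) →
    badBy c U D len h l (just x′) ≡ badBy c U D len h l (just x)
  badBy-rightNbr-swap len h l {x} {x′} b≥1 range |h|≡c apart x-in x′-in l-outside =
    badBy-nbr-invariant c U D len h l (just x′) l (just x) c≥1 parts b≥1 range |h|≡c λ s within →
      nbrIncreasing-right-invariant c s l x′ x c≥1 (same-side-of-average apart within x′-in x-in)
        λ l₀ e → same-side-of-letters (l-outside l₀ e) x′-in x-in

  badBy-leftNbr-swap : ∀ len (h : Word) r {x x′ a b} → 1 ≤ b → LetterRange b c h → length h ≡ c →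
    a + c ≤ b ⊎ b + c ≤ a → a ≤ x × x < a + c → a ≤ x′ × x′ < a + c →
    (∀ r₀ → r ≡ just r₀ → r₀ < a ⊎ a + c ≤ r₀) →
    badBy c U D len h (just x′) r ≡ badBy c U D len h (just x) r
  badBy-leftNbr-swap len h r {x} {x′} b≥1 range |h|≡c apart x-in x′-in r-outside =
    badBy-nbr-invariant c U D len h (just x′) r (just x) r c≥1 parts b≥1 range |h|≡c λ s within →
      nbrIncreasing-left-invariant c s x′ x r c≥1 (same-side-of-average apart within x′-in x-in)
        λ r₀ e → same-side-of-letters (r-outside r₀ e) x′-in x-in

  module _ {w : Word} (good : DistinctPositive w) {i : ℕ} (i+c≤n : i + c ≤ length w)
           {h′ : Word} (h′↭h : h′ ↭ sub c w i) (hit : any (formsIn (sub c w i)) U ≡ true) where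

    private
      w′ : Word
      w′ = replace c w i h′

      |h′|≡c : length h′ ≡ c
      |h′|≡c = trans (↭-length h′↭h) (length-sub c w i i+c≤n)

      |w′|≡|w| : length w′ ≡ length w
      |w′|≡|w| = length-replace c w h′ i i+c≤n |h′|≡c

      good′ : DistinctPositive w′
      good′ = DistinctPositive-resp-↭ (↭-sym (replace-↭ c w h′ i h′↭h)) good

      i+c≤n′ : i + c ≤ length w′
      i+c≤n′ = subst (i + c ≤_) (sym |w′|≡|w|) i+c≤n

      unchanged : ∀ {k} → k < i ⊎ i + c ≤ k → nth w′ k ≡ nth w k
      unchanged = nth-replace-outside c w h′ i i+c≤n |h′|≡c

      a : ℕ
      a = proj₁ (hit-range i c≥1 parts good hit)

      rangeA : LetterRange a c (sub c w i)
      rangeA = proj₂ (proj₂ (hit-range i c≥1 parts good hit))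

      rangeA′ : LetterRange a c (sub c w′ i)
      rangeA′ rewrite sub-replace c w h′ i i+c≤n |h′|≡c = record
        { bounded  = λ x∈ → LetterRange.bounded rangeA (∈-resp-↭ h′↭h x∈)
        ; complete = λ a≤x x<a+c → ∈-resp-↭ (↭-sym h′↭h) (LetterRange.complete rangeA a≤x x<a+c) }

      letter-at-i : ∃[ x ] nth w i ≡ just x
      letter-at-i = <⇒nth-just w i (<-≤-trans (m<m+n i c≥1) i+c≤n)

      letter-at-i′ : ∃[ x′ ] nth w′ i ≡ just x′
      letter-at-i′ = <⇒nth-just w′ i (<-≤-trans (m<m+n i c≥1) i+c≤n′)

      in-range : ∀ {v x} → LetterRange a c (sub c v i) → nth v i ≡ just x → a ≤ x × x < a + c
      in-range range e = inside-window range ≤-refl (m<m+n i c≥1) e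

      badWith : ℕ → Maybe ℕ → Maybe ℕ → Bool
      badWith j = badBy c U D (length w) (sub c w j)

      compare-if-hit : ∀ j → j + c ≤ length w → i + c ≤ j ⊎ j + c ≤ i → ∀ l r l′ r′ →
        (∀ {b} → 1 ≤ b → LetterRange b c (sub c w j) → a + c ≤ b ⊎ b + c ≤ a → badWith j l′ r′ ≡ badWith j l r) →
        badWith j l′ r′ ≡ badWith j l r
      compare-if-hit j j+c≤n apart l r l′ r′ swap = by-cases (any (formsIn (sub c w j)) U) refl
        where
        by-cases : ∀ hit? → any (formsIn (sub c w j)) U ≡ hit? → badWith j l′ r′ ≡ badWith j l r
        by-cases false no-hit rewrite no-hit = refl
        by-cases true  is-hit with b , b≥1 , rangeB ← hit-range j c≥1 parts good is-hit =
          swap b≥1 rangeB (nonoverlapping-ranges c≥1 (proj₁ good) rangeA rangeB apart)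

      bad-w : ∀ j → j + c ≤ length w → bad c U D w j ≡ badWith j (leftNbr w j) (rightNbr c w j)
      bad-w = bad-local c U parts D w

      bad-w′ : ∀ j → j + c ≤ length w → sub c w′ j ≡ sub c w j →
               bad c U D w′ j ≡ badWith j (leftNbr w′ j) (rightNbr c w′ j)
      bad-w′ j j+c≤n same-sub =
        trans (bad-local c U parts D w′ j (subst (j + c ≤_) (sym |w′|≡|w|) j+c≤n))
              (cong₂ (λ n h → badBy c U D n h (leftNbr w′ j) (rightNbr c w′ j)) |w′|≡|w| same-sub)

      i+c-1 : suc (i + (c ∸ 1)) ≡ i + c
      i+c-1 = trans (sym (+-suc i (c ∸ 1))) (cong (i +_) (m+[n∸m]≡n c≥1))

      last-letter : ∀ v → i + c ≤ length v → ∃[ y ] nth v (i + (c ∸ 1)) ≡ just y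
      last-letter v i+c≤|v| = <⇒nth-just v (i + (c ∸ 1)) (<-≤-trans (≤-reflexive i+c-1) i+c≤|v|)

      outside-i : ∀ {q x} → nth w q ≡ just x → q < i ⊎ i + c ≤ q → x < a ⊎ a + c ≤ x
      outside-i = outside-window rangeA (proj₁ good)

    bad-far : ∀ j → j + c ≤ length w → (∀ {k} → j ≤ suc k → k ≤ j + c → k < i ⊎ i + c ≤ k) →
              bad c U D w′ j ≡ bad c U D w j
    bad-far j j+c≤n far = begin
      bad c U D w′ j                           ≡⟨ bad-w′ j j+c≤n same-sub ⟩
      badWith j (leftNbr w′ j) (rightNbr c w′ j) ≡⟨ cong₂ (badWith j) same-left same-right ⟩
      badWith j (leftNbr w j) (rightNbr c w j)   ≡⟨ bad-w j j+c≤n ⟨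
      bad c U D w j                            ∎
      where
      open ≡-Reasoning
      same-sub : sub c w′ j ≡ sub c w j
      same-sub = sub-cong c w′ w j λ t t<c → unchanged (far (≤-trans (m≤m+n j t) (n≤1+n _)) (+-monoʳ-≤ j (<⇒≤ t<c)))
      same-left : leftNbr w′ j ≡ leftNbr w j
      same-left = leftNbr-cong w′ w j λ {k} 1+k≡j →
        unchanged (far (≤-reflexive (sym 1+k≡j)) (≤-trans (n≤1+n k) (≤-trans (≤-reflexive 1+k≡j) (m≤m+n j c))))
      same-right : rightNbr c w′ j ≡ rightNbr c w j
      same-right = unchanged (far (≤-trans (m≤m+n j c) (n≤1+n _)) ≤-refl)

    bad-adjacent-left : ∀ j → j + c ≡ i → bad c U D w′ j ≡ bad c U D w j
    bad-adjacent-left j j+c≡i with x , ex ← letter-at-i | x′ , ex′ ← letter-at-i′ = begin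
      bad c U D w′ j                             ≡⟨ bad-w′ j j+c≤n same-sub ⟩
      badWith j (leftNbr w′ j) (rightNbr c w′ j) ≡⟨ cong₂ (badWith j) same-left (right w′ ex′) ⟩
      badWith j (leftNbr w j) (just x′)          ≡⟨ compare-if-hit j j+c≤n apart l (just x) l (just x′) swap ⟩
      badWith j (leftNbr w j) (just x)           ≡⟨ cong (badWith j (leftNbr w j)) (right w ex) ⟨
      badWith j (leftNbr w j) (rightNbr c w j)   ≡⟨ bad-w j j+c≤n ⟨
      bad c U D w j                              ∎
      where
      open ≡-Reasoning
      j+c≤n : j + c ≤ length w
      j+c≤n = subst (_≤ length w) (sym j+c≡i) (≤-trans (m≤m+n i c) i+c≤n)
      same-sub : sub c w′ j ≡ sub c w j
      same-sub = sub-cong c w′ w j λ t t<c → unchanged (inj₁ (subst (j + t <_) j+c≡i (+-monoʳ-< j t<c)))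
      l = leftNbr w j
      apart : i + c ≤ j ⊎ j + c ≤ i
      apart = inj₂ (≤-reflexive j+c≡i)
      same-left : leftNbr w′ j ≡ leftNbr w j
      same-left = leftNbr-cong w′ w j λ {k} 1+k≡j →
        unchanged (inj₁ (subst (k <_) j+c≡i (<-≤-trans (≤-reflexive 1+k≡j) (m≤m+n j c))))
      right : ∀ v {x} → nth v i ≡ just x → rightNbr c v j ≡ just x
      right v e = subst (λ k → nth v k ≡ _) (sym j+c≡i) e
      swap : ∀ {b} → 1 ≤ b → LetterRange b c (sub c w j) → a + c ≤ b ⊎ b + c ≤ a →
             badWith j (leftNbr w j) (just x′) ≡ badWith j (leftNbr w j) (just x)
      swap b≥1 rangeB apart = badBy-rightNbr-swap (length w) (sub c w j) (leftNbr w j) b≥1 rangeB (length-sub c w j j+c≤n) apart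
        (in-range rangeA ex) (in-range rangeA′ ex′)
        λ l₀ e → let q , 1+q≡j , eq = leftNbr-position w j e
                 in outside-i eq (inj₁ (subst (q <_) j+c≡i (<-≤-trans (≤-reflexive 1+q≡j) (m≤m+n j c))))

    bad-adjacent-right : ∀ j → i + c ≡ j → j + c ≤ length w → bad c U D w′ j ≡ bad c U D w j
    bad-adjacent-right j i+c≡j j+c≤n with y , ey ← last-letter w i+c≤n | y′ , ey′ ← last-letter w′ i+c≤n′ = begin
      bad c U D w′ j                             ≡⟨ bad-w′ j j+c≤n same-sub ⟩
      badWith j (leftNbr w′ j) (rightNbr c w′ j) ≡⟨ cong₂ (badWith j) (left w′ ey′) same-right ⟩
      badWith j (just y′) (rightNbr c w j)       ≡⟨ compare-if-hit j j+c≤n apart (just y) r (just y′) r swap ⟩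
      badWith j (just y) (rightNbr c w j)        ≡⟨ cong (λ l → badWith j l (rightNbr c w j)) (left w ey) ⟨
      badWith j (leftNbr w j) (rightNbr c w j)   ≡⟨ bad-w j j+c≤n ⟨
      bad c U D w j                              ∎
      where
      open ≡-Reasoning
      r = rightNbr c w j
      apart : i + c ≤ j ⊎ j + c ≤ i
      apart = inj₁ (≤-reflexive i+c≡j)
      left : ∀ v {y} → nth v (i + (c ∸ 1)) ≡ just y → leftNbr v j ≡ just y
      left v e = subst (λ k → leftNbr v k ≡ _) (trans i+c-1 i+c≡j) e
      i+c≤ : ∀ t → i + c ≤ j + t
      i+c≤ t = ≤-trans (≤-reflexive i+c≡j) (m≤m+n j t)
      same-sub : sub c w′ j ≡ sub c w j
      same-sub = sub-cong c w′ w j λ t _ → unchanged (inj₂ (i+c≤ t))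
      same-right : rightNbr c w′ j ≡ rightNbr c w j
      same-right = unchanged (inj₂ (i+c≤ c))
      in-window : ∀ {v y} → LetterRange a c (sub c v i) → nth v (i + (c ∸ 1)) ≡ just y → a ≤ y × y < a + c
      in-window range e = inside-window range (m≤m+n i (c ∸ 1)) (≤-reflexive i+c-1) e
      swap : ∀ {b} → 1 ≤ b → LetterRange b c (sub c w j) → a + c ≤ b ⊎ b + c ≤ a →
             badWith j (just y′) (rightNbr c w j) ≡ badWith j (just y) (rightNbr c w j)
      swap b≥1 rangeB apart = badBy-leftNbr-swap (length w) (sub c w j) (rightNbr c w j) b≥1 rangeB (length-sub c w j j+c≤n) apart
        (in-window rangeA ey) (in-window rangeA′ ey′) λ r₀ e → outside-i e (inj₂ (i+c≤ c))

    bad-overlapping : ∀ j → (i < j × j < i + c) ⊎ (j < i × i < j + c) → bad c U D w′ j ≡ bad c U D w j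
    bad-overlapping j overlapping = trans (overlapping-not-bad w′ i j good′ i+c≤n′ rangeA′ overlapping)
                                          (sym (overlapping-not-bad w i j good i+c≤n rangeA overlapping))

    bad-elsewhere : ∀ j → j ≢ i → bad c U D w′ j ≡ bad c U D w j
    bad-elsewhere j j≢i with j + c ≤? length w
    ... | no  j+c≰n = same-value (bad-beyond-end c U D w′ j (j+c≰n ∘ subst (j + c ≤_) |w′|≡|w|))
                                 (bad-beyond-end c U D w j j+c≰n)
    ... | yes j+c≤n with <-cmp (j + c) i | <-cmp j i | <-cmp (i + c) j
    ...   | tri< j+c<i _ _ | _ | _ = bad-far j j+c≤n λ _ k≤j+c → inj₁ (≤-<-trans k≤j+c j+c<i)
    ...   | tri≈ _ j+c≡i _ | _ | _ = bad-adjacent-left j j+c≡i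
    ...   | tri> _ _ i<j+c | tri< j<i _ _ | _ = bad-overlapping j (inj₂ (j<i , i<j+c))
    ...   | tri> _ _ _     | tri≈ _ j≡i _ | _ = ⊥-elim (j≢i j≡i)
    ...   | tri> _ _ _     | tri> _ _ i<j | tri< i+c<j _ _ = bad-far j j+c≤n λ j≤1+k _ → inj₂ (≤-pred (<-≤-trans i+c<j j≤1+k))
    ...   | tri> _ _ _     | tri> _ _ i<j | tri≈ _ i+c≡j _ = bad-adjacent-right j i+c≡j j+c≤n
    ...   | tri> _ _ _     | tri> _ _ i<j | tri> _ _ j<i+c = bad-overlapping j (inj₁ (i<j , j<i+c))

    private
      badCount-w′ : badCount c U D w′ ≡ countB (bad c U D w′) (upTo (length w))
      badCount-w′ = cong (λ n → countB (bad c U D w′) (upTo n)) |w′|≡|w|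

    badCount-unchanged : bad c U D w′ i ≡ bad c U D w i → badCount c U D w′ ≡ badCount c U D w
    badCount-unchanged same-at-i = trans badCount-w′ (countB-cong (bad c U D w′) (bad c U D w) (upTo (length w)) agree)
      where
      agree : ∀ {j} → j ∈ upTo (length w) → bad c U D w′ j ≡ bad c U D w j
      agree {j} j∈ with j ≟ i
      ... | yes refl = same-at-i
      ... | no  j≢i  = bad-elsewhere j j≢i

    badCount-decreases : bad c U D w i ≡ true → bad c U D w′ i ≡ false → suc (badCount c U D w′) ≡ badCount c U D w
    badCount-decreases bad-before not-bad-after = trans (cong suc badCount-w′) (sym
      (countB-except-one (bad c U D w) (bad c U D w′) (upTo (length w)) (Unique.upTo⁺ (length w))
        (∈-upTo⁺ (<-≤-trans (m<m+n i c≥1) i+c≤n)) bad-before not-bad-after λ _ j≢i → sym (bad-elsewhere _ j≢i)))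

isPHit⁻ : ∀ c P (w : Word) i → isPHit c P w i ≡ true → i + c ≤ length w × any (formsIn (sub c w i)) P ≡ true
isPHit⁻ c P w i hit with fits , is-hit ← ∧-true⁻ hit = ≤ᵇ⇒≤ _ _ (subst T (sym fits) _) , is-hit

lemma2p5 : (c n : ℕ) → 1 ≤ c → c ≤ n →
    (U : List (List Word)) (D : List Word) →
    IsPartitionOfSubset c U → IsStraighteningSet U D → IsConfluentFor c n U D →
    (∀ (w w' : Word) (i : ℕ) → IsPerm n w → isPHit c U w i ≡ true →
       forward c w i ≡ true → Straighten c U D w i w' →
       badCount c U D w' ≡ badCount c U D w)
    ×
    (∀ (w w' : Word) (i : ℕ) → IsPerm n w → isPHit c U w i ≡ true →
       backward c w i ≡ true → straightened c U D w i ≡ false →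
       Straighten c U D w i w' →
       suc (badCount c U D w') ≡ badCount c U D w)
lemma2p5 c n c≥1 _ U D (_ , parts , _) _ _ = straighten-forward , straighten-backward
  where
  straighten-forward : ∀ (w w′ : Word) i → IsPerm n w → isPHit c U w i ≡ true →
    forward c w i ≡ true → Straighten c U D w i w′ → badCount c U D w′ ≡ badCount c U D w
  straighten-forward w _ i w∈Sₙ hit fw ((h′ , refl , h′↭h , _) , straightened′)
    with i+c≤n , U-hit ← isPHit⁻ c U w i hit =
    badCount-unchanged D c≥1 parts (IsPerm⇒DistinctPositive n w∈Sₙ) i+c≤n h′↭h U-hit
      (trans (bad-if-straightened c U D _ i straightened′) (sym (bad-if-forward c U D w i (not-injective fw))))

  straighten-backward : ∀ (w w′ : Word) i → IsPerm n w → isPHit c U w i ≡ true →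
    backward c w i ≡ true → straightened c U D w i ≡ false → Straighten c U D w i w′ →
    suc (badCount c U D w′) ≡ badCount c U D w
  straighten-backward w _ i w∈Sₙ hit bw not-straightened ((h′ , refl , h′↭h , _) , straightened′)
    with i+c≤n , U-hit ← isPHit⁻ c U w i hit =
    badCount-decreases D c≥1 parts (IsPerm⇒DistinctPositive n w∈Sₙ) i+c≤n h′↭h U-hit bad-before
      (bad-if-straightened c U D _ i straightened′)
    where
    bad-before : bad c U D w i ≡ true
    bad-before rewrite hit | bw | not-straightened = refl
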